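{- Let $G$ be a (finite, simple) triangle-free $(2k+1)$-regular graph containing a perfect matching, and let $k_1,k_2$ be positive integers with $k_1+k_2=k-1$. Then $G$ is $\{S_{k_1,k_2},S_{k_1+1,k_2}\}$-decomposable.
   Context: For positive integers $a,b$, $S_{a,b}$ denotes the double-star with degree sequence $(a+1,b+1,1,\ldots,1)$, i.e. the tree obtained from an edge $u_1u_2$ by attaching $a$ pendant vertices to $u_1$ and $b$ pendant vertices to $u_2$. A graph $G$ is $\{H_1,\ldots,H_m\}$-decomposable if $E(G)$ can be partitioned into subsets each of which forms a subgraph isomorphic to some $H_i$. -}

module Defs where

open import Data.Nat using (ℕ; zero; suc; _+_; _*_)
open import Data.Bool using (Bool; true; false)
open import Data.Fin using (Fin; zero; suc; _↑ˡ_; _↑ʳ_)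
open import Data.Fin.Properties using (_≟_)
open import Data.List using (List; []; _∷_; _++_; map; allFin; filter; length; concatMap)
open import Data.List.Relation.Unary.All using (All)
open import Data.List.Membership.Propositional using (_∈_)
open import Data.Product using (_×_; _,_; proj₁; proj₂; Σ; ∃)
open import Data.Sum using (_⊎_)
open import Relation.Binary.PropositionalEquality using (_≡_; _≢_)
open import Relation.Nullary using (¬_; Dec)
open import Relation.Nullary.Decidable using (_×-dec_; _⊎-dec_)
open import Data.Empty using (⊥)
open import Function.Definitions using (Injective)

record Graph (n : ℕ) : Set where
  field
    adj   : Fin n → Fin n → Bool
    sym   : ∀ u v → adj u v ≡ adj v u
    irrefl : ∀ v → adj v v ≡ false

open Graph public

Adj : ∀ {n} → Graph n → Fin n → Fin n → Set
Adj G u v = adj G u v ≡ true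

degree : ∀ {n} → Graph n → Fin n → ℕ
degree {n} G v = length (filter (λ w → Data.Bool._≟_ (adj G v w) true) (allFin n))

Regular : ∀ {n} → Graph n → ℕ → Set
Regular G d = ∀ v → degree G v ≡ d

TriangleFree : ∀ {n} → Graph n → Set
TriangleFree G = ∀ u v w → Adj G u v → Adj G v w → Adj G u w → ⊥

-- A perfect matching: a fixed-point-free involution m with every v m(v) an edge.
HasPerfectMatching : ∀ {n} → Graph n → Set
HasPerfectMatching {n} G =
  Σ (Fin n → Fin n) λ m → (∀ v → m (m v) ≡ v) × (∀ v → Adj G v (m v))

-- The double star S_{a,b} on vertex set Fin (2 + a + b):
-- vertex 0 = u₁, vertex 1 = u₂, the next a vertices are the leaves at u₁,
-- the last b vertices are the leaves at u₂.
dsEdges : (a b : ℕ) → List (Fin (2 + a + b) × Fin (2 + a + b))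
dsEdges a b =
  (zero , suc zero)
  ∷ (map (λ i → (zero , suc (suc (i ↑ˡ b)))) (allFin a)
     ++ map (λ j → (suc zero , suc (suc (a ↑ʳ j)))) (allFin b))

record DSCopy {n : ℕ} (G : Graph n) : Set where
  field
    a b   : ℕ
    f     : Fin (2 + a + b) → Fin n
    f-inj : Injective _≡_ _≡_ f
    f-edge : All (λ e → Adj G (f (proj₁ e)) (f (proj₂ e))) (dsEdges a b)

open DSCopy public

copyEdges : ∀ {n} {G : Graph n} → DSCopy G → List (Fin n × Fin n)
copyEdges c = map (λ e → (f c (proj₁ e) , f c (proj₂ e))) (dsEdges (a c) (b c))

SameEdge : ∀ {n} → Fin n → Fin n → Fin n × Fin n → Set
SameEdge x y e = (proj₁ e ≡ x × proj₂ e ≡ y) ⊎ (proj₁ e ≡ y × proj₂ e ≡ x)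

sameEdge? : ∀ {n} (x y : Fin n) (e : Fin n × Fin n) → Dec (SameEdge x y e)
sameEdge? x y e = ((proj₁ e ≟ x) ×-dec (proj₂ e ≟ y)) ⊎-dec ((proj₁ e ≟ y) ×-dec (proj₂ e ≟ x))

-- G is {S_{a₁,b₁},…,S_{a_m,b_m}}-decomposable: there is a family of copies
-- of members of the list Hs whose edge sets partition E(G), i.e. every
-- edge of G is used exactly once in total (copy edges are edges of G).
Decomposable : ∀ {n} → Graph n → List (ℕ × ℕ) → Set
Decomposable G Hs =
  Σ (List (DSCopy G)) λ cs →
    All (λ c → (a c , b c) ∈ Hs) cs ×
    (∀ x y → Adj G x y →
      length (filter (sameEdge? x y) (concatMap copyEdges cs)) ≡ 1)

module Submission where

-- Removing the perfect matching leaves a 2k-regular graph, which has an Eulerian orientation with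
-- in- and out-degree k everywhere. Its bipartite double cover is k-regular, so it has a perfect
-- matching (found by Alon's repeated halving): a permutation φ with an arc x → φ x at every x.
-- Orienting the matching edges arbitrarily, the out-arcs of each y other than y → φ y are k₁ or
-- k₁ + 1 "own" arcs and k₂ "lent" arcs. The double star centred at x consists of x → φ x, the own
-- arcs of x and the lent arcs of φ x; as φ is a permutation every arc is used exactly once, and
-- triangle-freeness keeps the leaves at x and at φ x apart.

open import Defs hiding (sym)
open import Data.Nat using (ℕ; zero; suc; _+_; _*_; _∸_; _⊓_; _^_; _≤_; _<_; _≥_; z≤n; s≤s; _≤?_; _<?_)
open import Data.Nat.Properties hiding (_≟_)
open import Data.Nat.DivMod using (_/_; _%_; m≡m%n+[m/n]*n; m%n<n)
open import Data.Nat.Tactic.RingSolver using (solve-∀)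
open import Data.Bool using (Bool; true; false; not; _xor_; if_then_else_) renaming (_≟_ to _≟ᵇ_)
open import Data.Fin using (Fin; zero; suc; toℕ; splitAt; join; _↑ˡ_; _↑ʳ_)
open import Data.Fin.Properties using (_≟_; toℕ-injective; splitAt-↑ˡ; splitAt-↑ʳ; join-splitAt)
open import Data.Fin.Permutation using (permutation)
open import Data.Product using (Σ; _×_; _,_; proj₁; proj₂; swap)
open import Data.Sum using (_⊎_; inj₁; inj₂; [_,_]′)
import Data.Sum.Properties as Sum
open import Data.List using (List; []; _∷_; _++_; length; map; allFin; filter; concatMap; take; drop; lookup)
open import Data.List.Properties
  using (length-map; length-take; length-drop; take++drop≡id; map-∘; map-cong; map-++; map-tabulate; length-tabulate; tabulate-lookup)
open import Data.List.Membership.Propositional using (_∈_)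
open import Data.List.Membership.Propositional.Properties
  using (∈-filter⁺; ∈-filter⁻; ∈-++⁺ˡ; ∈-++⁺ʳ; ∈-++⁻; ∈-map⁻; ∈-lookup)
open import Data.List.Relation.Unary.Any using (here; there)
open import Data.List.Relation.Unary.All using (All)
import Data.List.Relation.Unary.All as All
import Data.List.Relation.Unary.All.Properties as All
open import Data.Empty using (⊥; ⊥-elim)
open import Data.Unit using (⊤; tt)
open import Function.Definitions using (Injective)
open import Relation.Binary.Definitions using (DecidableEquality; tri<; tri≈; tri>)
open import Relation.Binary.PropositionalEquality hiding ([_])
open import Relation.Nullary using (Dec; yes; no; ¬_; does; ¬?)
open import Relation.Nullary.Decidable using (_×-dec_)
open import Relation.Unary using (Pred; Decidable)
open import Level using (0ℓ)
open import Algebra.Properties.CommutativeSemigroup +-commutativeSemigroup using (interchange; x∙yz≈y∙xz; xy∙z≈xz∙y)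
open import Algebra.Properties.CommutativeMonoid.Sum +-0-commutativeMonoid as Σℕ using (∑-permute)

private variable
  A B V : Set

𝟙 : {P : Set} → Dec P → ℕ
𝟙 d = if does d then 1 else 0

𝟙-yes : {P : Set} (d : Dec P) → P → 𝟙 d ≡ 1
𝟙-yes (yes _) _ = refl
𝟙-yes (no ¬p) p = ⊥-elim (¬p p)

𝟙-no : {P : Set} (d : Dec P) → ¬ P → 𝟙 d ≡ 0
𝟙-no (yes p) ¬p = ⊥-elim (¬p p)
𝟙-no (no _) _ = refl

𝟙≤1 : {P : Set} (d : Dec P) → 𝟙 d ≤ 1
𝟙≤1 (yes _) = ≤-refl
𝟙≤1 (no _) = z≤n

𝟙-cong : {P Q : Set} (d : Dec P) (e : Dec Q) → (P → Q) → (Q → P) → 𝟙 d ≡ 𝟙 e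
𝟙-cong (yes p) e f g = sym (𝟙-yes e (f p))
𝟙-cong (no ¬p) e f g = sym (𝟙-no e (λ q → ¬p (g q)))

sumBy : (A → ℕ) → List A → ℕ
sumBy w [] = 0
sumBy w (x ∷ L) = w x + sumBy w L

sumBy-++ : (w : A → ℕ) (X Y : List A) → sumBy w (X ++ Y) ≡ sumBy w X + sumBy w Y
sumBy-++ w [] Y = refl
sumBy-++ w (x ∷ X) Y = trans (cong (w x +_) (sumBy-++ w X Y)) (sym (+-assoc (w x) _ _))

sumBy-map : (w : B → ℕ) (h : A → B) (L : List A) → sumBy w (map h L) ≡ sumBy (λ a → w (h a)) L
sumBy-map w h [] = refl
sumBy-map w h (x ∷ L) = cong (w (h x) +_) (sumBy-map w h L)

sumBy-concatMap : (w : B → ℕ) (g : A → List B) (L : List A) →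
  sumBy w (concatMap g L) ≡ sumBy (λ a → sumBy w (g a)) L
sumBy-concatMap w g [] = refl
sumBy-concatMap w g (x ∷ L) =
  trans (sumBy-++ w (g x) (concatMap g L)) (cong (sumBy w (g x) +_) (sumBy-concatMap w g L))

sumBy-cong-∈ : {w w' : A → ℕ} (L : List A) → (∀ e → e ∈ L → w e ≡ w' e) → sumBy w L ≡ sumBy w' L
sumBy-cong-∈ [] h = refl
sumBy-cong-∈ (x ∷ L) h = cong₂ _+_ (h x (here refl)) (sumBy-cong-∈ L (λ e m → h e (there m)))

sumBy-cong : {w w' : A → ℕ} (L : List A) → (∀ e → w e ≡ w' e) → sumBy w L ≡ sumBy w' L
sumBy-cong L h = sumBy-cong-∈ L (λ e _ → h e)

sumBy-mono : {w w' : A → ℕ} (L : List A) → (∀ e → w e ≤ w' e) → sumBy w L ≤ sumBy w' L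
sumBy-mono [] h = z≤n
sumBy-mono (x ∷ L) h = +-mono-≤ (h x) (sumBy-mono L h)

sumBy-+ : (w w' : A → ℕ) (L : List A) → sumBy (λ e → w e + w' e) L ≡ sumBy w L + sumBy w' L
sumBy-+ w w' [] = refl
sumBy-+ w w' (x ∷ L) rewrite sumBy-+ w w' L = interchange (w x) (w' x) (sumBy w L) (sumBy w' L)

sumBy-zero : (L : List A) → sumBy (λ _ → 0) L ≡ 0
sumBy-zero [] = refl
sumBy-zero (x ∷ L) = sumBy-zero L

sumBy-*ˡ : (c : ℕ) (w : A → ℕ) (L : List A) → sumBy (λ e → c * w e) L ≡ c * sumBy w L
sumBy-*ˡ c w [] = sym (*-zeroʳ c)
sumBy-*ˡ c w (x ∷ L) = trans (cong (c * w x +_) (sumBy-*ˡ c w L)) (sym (*-distribˡ-+ c (w x) (sumBy w L)))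

sumBy-swap : (W : A → B → ℕ) (X : List A) (Y : List B) →
  sumBy (λ a → sumBy (W a) Y) X ≡ sumBy (λ b → sumBy (λ a → W a b) X) Y
sumBy-swap W [] Y = sym (sumBy-zero Y)
sumBy-swap W (x ∷ X) Y =
  trans (cong (sumBy (W x) Y +_) (sumBy-swap W X Y)) (sym (sumBy-+ (W x) (λ b → sumBy (λ a → W a b) X) Y))

sumBy-filter : {P : Pred A 0ℓ} (P? : Decidable P) (w : A → ℕ) (L : List A) →
  sumBy w (filter P? L) ≡ sumBy (λ e → 𝟙 (P? e) * w e) L
sumBy-filter P? w [] = refl
sumBy-filter P? w (x ∷ L) with P? x
... | yes _ = cong₂ _+_ (sym (+-identityʳ (w x))) (sumBy-filter P? w L)
... | no _ = sumBy-filter P? w L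

sumBy-partition : {P : Pred A 0ℓ} (P? : Decidable P) (w : A → ℕ) (L : List A) →
  sumBy w (filter P? L) + sumBy w (filter (λ e → ¬? (P? e)) L) ≡ sumBy w L
sumBy-partition P? w [] = refl
sumBy-partition P? w (x ∷ L) with P? x
... | yes _ = trans (+-assoc (w x) _ _) (cong (w x +_) (sumBy-partition P? w L))
... | no _ = trans (x∙yz≈y∙xz (sumBy w (filter P? L)) (w x) _) (cong (w x +_) (sumBy-partition P? w L))

length≡sumBy1 : (L : List A) → length L ≡ sumBy (λ _ → 1) L
length≡sumBy1 [] = refl
length≡sumBy1 (x ∷ L) = cong suc (length≡sumBy1 L)

length-filter≡sumBy𝟙 : {P : Pred A 0ℓ} (P? : Decidable P) (L : List A) →
  length (filter P? L) ≡ sumBy (λ e → 𝟙 (P? e)) L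
length-filter≡sumBy𝟙 P? L = begin
  length (filter P? L)                 ≡⟨ length≡sumBy1 (filter P? L) ⟩
  sumBy (λ _ → 1) (filter P? L)        ≡⟨ sumBy-filter P? (λ _ → 1) L ⟩
  sumBy (λ e → 𝟙 (P? e) * 1) L         ≡⟨ sumBy-cong L (λ e → *-identityʳ (𝟙 (P? e))) ⟩
  sumBy (λ e → 𝟙 (P? e)) L             ∎
  where open ≡-Reasoning

sumBy-take+drop : (w : A → ℕ) (m : ℕ) (L : List A) → sumBy w (take m L) + sumBy w (drop m L) ≡ sumBy w L
sumBy-take+drop w m L = trans (sym (sumBy-++ w (take m L) (drop m L))) (cong (sumBy w) (take++drop≡id m L))

sumBy-singleton : (w : A → ℕ) (c : A) (L : List A) → length L ≡ 1 → (∀ e → e ∈ L → e ≡ c) → sumBy w L ≡ w c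
sumBy-singleton w c (x ∷ []) refl h rewrite h x (here refl) = +-identityʳ (w c)

∈⇒≤sumBy : (w : A → ℕ) {e : A} (L : List A) → e ∈ L → w e ≤ sumBy w L
∈⇒≤sumBy w (x ∷ L) (here refl) = m≤m+n (w x) _
∈⇒≤sumBy w (x ∷ L) (there m) = ≤-trans (∈⇒≤sumBy w L m) (m≤n+m _ (w x))

∈-distinct⇒2≤sumBy : (w : A → ℕ) {e₁ e₂ : A} (L : List A) → e₁ ∈ L → e₂ ∈ L → e₁ ≢ e₂ →
  1 ≤ w e₁ → 1 ≤ w e₂ → 2 ≤ sumBy w L
∈-distinct⇒2≤sumBy w (x ∷ L) (here refl) (here refl) ne _ _ = ⊥-elim (ne refl)
∈-distinct⇒2≤sumBy w (x ∷ L) (here refl) (there m₂) ne h₁ h₂ = +-mono-≤ h₁ (≤-trans h₂ (∈⇒≤sumBy w L m₂))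
∈-distinct⇒2≤sumBy w (x ∷ L) (there m₁) (here refl) ne h₁ h₂ = +-mono-≤ h₂ (≤-trans h₁ (∈⇒≤sumBy w L m₁))
∈-distinct⇒2≤sumBy w (x ∷ L) (there m₁) (there m₂) ne h₁ h₂ =
  ≤-trans (∈-distinct⇒2≤sumBy w L m₁ m₂ ne h₁ h₂) (m≤n+m _ (w x))

map-tails : (x : A) (L : List (A × B)) → (∀ {e} → e ∈ L → x ≡ proj₁ e) → map (λ v → x , v) (map proj₂ L) ≡ L
map-tails x [] tails = refl
map-tails x (e ∷ L) tails = cong₂ _∷_ (cong (_, proj₂ e) (tails (here refl))) (map-tails x L (λ e∈ → tails (there e∈)))

repeat : ℕ → List A → List A
repeat zero L = []
repeat (suc m) L = L ++ repeat m L

sumBy-repeat : (w : A → ℕ) (m : ℕ) (L : List A) → sumBy w (repeat m L) ≡ m * sumBy w L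
sumBy-repeat w zero L = refl
sumBy-repeat w (suc m) L = trans (sumBy-++ w L (repeat m L)) (cong (sumBy w L +_) (sumBy-repeat w m L))

∈-repeat : ∀ m (L : List A) {e} → e ∈ repeat m L → e ∈ L
∈-repeat (suc m) L e∈ with ∈-++⁻ L e∈
... | inj₁ e∈L = e∈L
... | inj₂ e∈rep = ∈-repeat m L e∈rep

allFin-suc : ∀ n → allFin (suc n) ≡ zero ∷ map suc (allFin n)
allFin-suc n = cong (zero ∷_) (sym (map-tabulate (λ i → i) suc))

sumBy-allFin-suc : ∀ {n} (f : Fin (suc n) → ℕ) → sumBy f (allFin (suc n)) ≡ f zero + sumBy (λ i → f (suc i)) (allFin n)
sumBy-allFin-suc {n} f = trans (cong (sumBy f) (allFin-suc n)) (cong (f zero +_) (sumBy-map f suc (allFin n)))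

sumBy-allFin≡∑ : ∀ {n} (f : Fin n → ℕ) → sumBy f (allFin n) ≡ Σℕ.sum f
sumBy-allFin≡∑ {zero} f = refl
sumBy-allFin≡∑ {suc n} f = trans (sumBy-allFin-suc f) (cong (f zero +_) (sumBy-allFin≡∑ (λ i → f (suc i))))

sumBy-allFin-δ : ∀ {n} (z : Fin n) (g : Fin n → ℕ) → sumBy (λ a → 𝟙 (z ≟ a) * g a) (allFin n) ≡ g z
sumBy-allFin-δ {suc n} zero g = begin
  sumBy (λ a → 𝟙 (zero ≟ a) * g a) (allFin (suc n)) ≡⟨ sumBy-allFin-suc (λ a → 𝟙 (zero ≟ a) * g a) ⟩
  g zero + 0 + sumBy (λ _ → 0) (allFin n)           ≡⟨ cong₂ _+_ (+-identityʳ (g zero)) (sumBy-zero (allFin n)) ⟩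
  g zero + 0                                          ≡⟨ +-identityʳ (g zero) ⟩
  g zero                                              ∎
  where open ≡-Reasoning
sumBy-allFin-δ {suc n} (suc z) g =
  trans (sumBy-allFin-suc (λ a → 𝟙 (suc z ≟ a) * g a)) (sumBy-allFin-δ z (λ a → g (suc a)))

sumBy-allFin-permute : ∀ {n} (φ ψ : Fin n → Fin n) → (∀ y → φ (ψ y) ≡ y) → (∀ x → ψ (φ x) ≡ x) →
  (g : Fin n → ℕ) → sumBy (λ x → g (φ x)) (allFin n) ≡ sumBy g (allFin n)
sumBy-allFin-permute {n} φ ψ φψ ψφ g = begin
  sumBy (λ x → g (φ x)) (allFin n) ≡⟨ sumBy-allFin≡∑ (λ x → g (φ x)) ⟩
  Σℕ.sum (λ x → g (φ x))            ≡⟨ sym (∑-permute g (permutation φ ψ φψ ψφ)) ⟩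
  Σℕ.sum g                          ≡⟨ sym (sumBy-allFin≡∑ g) ⟩
  sumBy g (allFin n)                ∎
  where open ≡-Reasoning

Even : ℕ → Set
Even 0 = ⊤
Even 1 = ⊥
Even (suc (suc n)) = Even n

Even-double : ∀ k → Even (k + k)
Even-double zero = tt
Even-double (suc k) rewrite +-suc k k = Even-double k

Even-double+ : ∀ i d → Even (i + i + d) → Even d
Even-double+ zero d e = e
Even-double+ (suc i) d e rewrite +-suc i i = Even-double+ i d e

Even-suc⇒≢0 : ∀ d → Even (suc d) → d ≢ 0
Even-suc⇒≢0 .0 () refl

m+m≡n+n⇒m≡n : ∀ m n → m + m ≡ n + n → m ≡ n
m+m≡n+n⇒m≡n zero zero p = refl
m+m≡n+n⇒m≡n (suc m) (suc n) p rewrite +-suc m m | +-suc n n =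
  cong suc (m+m≡n+n⇒m≡n m n (suc-injective (suc-injective p)))

-- Eulerian orientations

flipIf : Bool → V × V → V × V
flipIf false e = e
flipIf true e = swap e

flipIf-xor : (b g : Bool) (e : V × V) → flipIf (g xor b) e ≡ flipIf b (flipIf g e)
flipIf-xor false false e = refl
flipIf-xor false true e = refl
flipIf-xor true false e = refl
flipIf-xor true true e = refl

-- An orientation of an arc list is read off a list of bits; missing bits count as false.
hd : List Bool → Bool
hd [] = false
hd (b ∷ _) = b

tl : List Bool → List Bool
tl [] = []
tl (_ ∷ bs) = bs

orient : List (V × V) → List Bool → List (V × V)
orient [] bs = []
orient (e ∷ L) bs = flipIf (hd bs) e ∷ orient L (tl bs)

takeBits : ℕ → List Bool → List Bool
takeBits zero bs = []
takeBits (suc m) bs = hd bs ∷ takeBits m (tl bs)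

dropBits : ℕ → List Bool → List Bool
dropBits zero bs = bs
dropBits (suc m) bs = dropBits m (tl bs)

orient-++ : (A B : List (V × V)) (bs : List Bool) →
  orient (A ++ B) bs ≡ orient A bs ++ orient B (dropBits (length A) bs)
orient-++ [] B bs = refl
orient-++ (e ∷ A) B bs = cong (flipIf (hd bs) e ∷_) (orient-++ A B (tl bs))

orient-insert : (A : List (V × V)) (e : V × V) (B : List (V × V)) (bs : List Bool) (γ : Bool) →
  orient (A ++ e ∷ B) (takeBits (length A) bs ++ γ ∷ dropBits (length A) bs)
    ≡ orient A bs ++ flipIf γ e ∷ orient B (dropBits (length A) bs)
orient-insert [] e B bs γ = refl
orient-insert (x ∷ A) e B bs γ = cong (flipIf (hd bs) x ∷_) (orient-insert A e B (tl bs) γ)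

length-insert : (X : List A) (e : A) (Y : List A) → length (X ++ e ∷ Y) ≡ suc (length (X ++ Y))
length-insert [] e Y = refl
length-insert (x ∷ X) e Y = cong suc (length-insert X e Y)

∈-orient : (L : List (V × V)) (bs : List Bool) {e : V × V} →
  e ∈ orient L bs → Σ (V × V) λ e′ → e′ ∈ L × (e ≡ e′ ⊎ e ≡ swap e′)
∈-orient (x ∷ L) bs (here refl) with hd bs
... | false = x , here refl , inj₁ refl
... | true = x , here refl , inj₂ refl
∈-orient (x ∷ L) bs (there e∈) with ∈-orient L (tl bs) e∈
... | e′ , e′∈ , e≈e′ = e′ , there e′∈ , e≈e′

sumBy-orient : (w : V × V → ℕ) → (∀ e → w (swap e) ≡ w e) →
  ∀ L bs → sumBy w (orient L bs) ≡ sumBy w L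
sumBy-orient w w-swap [] bs = refl
sumBy-orient w w-swap (e ∷ L) bs with hd bs
... | false = cong (w e +_) (sumBy-orient w w-swap L (tl bs))
... | true = cong₂ _+_ (w-swap e) (sumBy-orient w w-swap L (tl bs))

module Arcs {V : Set} (_≟_ : DecidableEquality V) where

  δ : V → V → ℕ
  δ x y = 𝟙 (x ≟ y)

  δ-refl : ∀ x → δ x x ≡ 1
  δ-refl x = 𝟙-yes (x ≟ x) refl

  δ-≢ : ∀ {x y} → x ≢ y → δ x y ≡ 0
  δ-≢ {x} {y} = 𝟙-no (x ≟ y)

  δ-sym : ∀ x y → δ x y ≡ δ y x
  δ-sym x y = 𝟙-cong (x ≟ y) (y ≟ x) sym sym

  outdeg indeg deg : V → List (V × V) → ℕ
  outdeg x = sumBy (λ e → δ x (proj₁ e))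
  indeg x = sumBy (λ e → δ x (proj₂ e))
  deg x L = outdeg x L + indeg x L

  degArc : V → V × V → ℕ
  degArc x e = δ x (proj₁ e) + δ x (proj₂ e)

  degArc-flipIf : ∀ x b e → degArc x (flipIf b e) ≡ degArc x e
  degArc-flipIf x false e = refl
  degArc-flipIf x true (u , v) = +-comm (δ x v) (δ x u)

  deg-∷ : ∀ x e L → deg x (e ∷ L) ≡ degArc x e + deg x L
  deg-∷ x e L = interchange (δ x (proj₁ e)) (outdeg x L) (δ x (proj₂ e)) (indeg x L)

  deg-orient : ∀ x L bs → deg x (orient L bs) ≡ deg x L
  deg-orient x [] bs = refl
  deg-orient x (e ∷ L) bs = begin
    deg x (flipIf (hd bs) e ∷ orient L (tl bs))      ≡⟨ deg-∷ x (flipIf (hd bs) e) (orient L (tl bs)) ⟩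
    degArc x (flipIf (hd bs) e) + deg x (orient L (tl bs))
      ≡⟨ cong₂ _+_ (degArc-flipIf x (hd bs) e) (deg-orient x L (tl bs)) ⟩
    degArc x e + deg x L                             ≡⟨ sym (deg-∷ x e L) ⟩
    deg x (e ∷ L)                                    ∎
    where open ≡-Reasoning

  sumBy-insert : (w : V × V → ℕ) (A : List (V × V)) (e : V × V) (B : List (V × V)) →
    sumBy w (A ++ e ∷ B) ≡ w e + sumBy w (A ++ B)
  sumBy-insert w [] e B = refl
  sumBy-insert w (x ∷ A) e B = trans (cong (w x +_) (sumBy-insert w A e B)) (x∙yz≈y∙xz (w x) (w e) _)

  successor : ∀ x L → outdeg x L ≢ 0 → Σ V λ y → (x , y) ∈ L
  successor x [] deg≢0 = ⊥-elim (deg≢0 refl)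
  successor x ((u , v) ∷ L) deg≢0 with x ≟ u
  ... | yes refl = v , here refl
  ... | no _ with successor x L deg≢0
  ...   | y , x→y = y , there x→y

  predecessor : ∀ y L → indeg y L ≢ 0 → Σ V λ x → (x , y) ∈ L
  predecessor y [] deg≢0 = ⊥-elim (deg≢0 refl)
  predecessor y ((u , v) ∷ L) deg≢0 with y ≟ v
  ... | yes refl = u , here refl
  ... | no _ with predecessor y L deg≢0
  ...   | x , x→y = x , there x→y

  successor-unique : ∀ x L {y y′} → outdeg x L ≤ 1 → (x , y) ∈ L → (x , y′) ∈ L → y ≡ y′
  successor-unique x L {y} {y′} deg≤1 x→y x→y′ with y ≟ y′
  ... | yes y≡y′ = y≡y′
  ... | no y≢y′ = ⊥-elim (<⇒≱ (s≤s deg≤1) (∈-distinct⇒2≤sumBy _ L x→y x→y′ (λ eq → y≢y′ (cong proj₂ eq))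
    (≤-reflexive (sym (δ-refl x))) (≤-reflexive (sym (δ-refl x)))))

  predecessor-unique : ∀ y L {x x′} → indeg y L ≤ 1 → (x , y) ∈ L → (x′ , y) ∈ L → x ≡ x′
  predecessor-unique y L {x} {x′} deg≤1 x→y x′→y with x ≟ x′
  ... | yes x≡x′ = x≡x′
  ... | no x≢x′ = ⊥-elim (<⇒≱ (s≤s deg≤1) (∈-distinct⇒2≤sumBy _ L x→y x′→y (λ eq → x≢x′ (cong proj₁ eq))
    (≤-reflexive (sym (δ-refl y))) (≤-reflexive (sym (δ-refl y)))))

  AtMostOnce : List V → Set
  AtMostOnce l = ∀ z → sumBy (δ z) l ≤ 1

  lookup-injective : ∀ l → AtMostOnce l → ∀ i j → lookup l i ≡ lookup l j → i ≡ j
  lookup-injective (z ∷ l) once zero zero eq = refl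
  lookup-injective (z ∷ l) once zero (suc j) eq =
    ⊥-elim (<⇒≱ (s≤s (once z)) (+-mono-≤ (≤-reflexive (sym (δ-refl z)))
      (≤-trans (≤-reflexive (sym (δ-refl z))) (∈⇒≤sumBy (δ z) l (subst (_∈ l) (sym eq) (∈-lookup j))))))
  lookup-injective (z ∷ l) once (suc i) zero eq =
    ⊥-elim (<⇒≱ (s≤s (once z)) (+-mono-≤ (≤-reflexive (sym (δ-refl z)))
      (≤-trans (≤-reflexive (sym (δ-refl z))) (∈⇒≤sumBy (δ z) l (subst (_∈ l) eq (∈-lookup i))))))
  lookup-injective (z ∷ l) once (suc i) (suc j) eq =
    cong suc (lookup-injective l (λ w → ≤-trans (m≤n+m _ _) (once w)) i j eq)

  enumerate : (l : List V) {m : ℕ} → length l ≡ m → Fin m → V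
  enumerate l refl = lookup l

  enumerate-∈ : ∀ l {m} (len : length l ≡ m) i → enumerate l len i ∈ l
  enumerate-∈ l refl = ∈-lookup

  map-enumerate : ∀ l {m} (len : length l ≡ m) → map (enumerate l len) (allFin m) ≡ l
  map-enumerate l refl = trans (map-tabulate (λ i → i) (lookup l)) (tabulate-lookup l)

  enumerate-injective : ∀ l {m} (len : length l ≡ m) → AtMostOnce l → ∀ i j → enumerate l len i ≡ enumerate l len j → i ≡ j
  enumerate-injective l refl = lookup-injective l

  Balanced : List (V × V) → Set
  Balanced L = ∀ x → outdeg x L ≡ indeg x L

  EvenDegrees : List (V × V) → Set
  EvenDegrees L = ∀ x → Even (deg x L)

  -- Replacing the arc b → c by the path b → a → c (inserted anywhere) preserves balance.
  balanced-subdivide : ∀ β a b c A B → Balanced (flipIf β (b , c) ∷ (A ++ B)) →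
    Balanced (flipIf (not β) (a , b) ∷ (A ++ flipIf β (a , c) ∷ B))
  balanced-subdivide false a b c A B bal x = begin
    δ x b + outdeg x (A ++ (a , c) ∷ B)  ≡⟨ cong (δ x b +_) (sumBy-insert (λ e → δ x (proj₁ e)) A (a , c) B) ⟩
    δ x b + (δ x a + outdeg x (A ++ B))  ≡⟨ x∙yz≈y∙xz (δ x b) (δ x a) _ ⟩
    δ x a + (δ x b + outdeg x (A ++ B))  ≡⟨ cong (δ x a +_) (bal x) ⟩
    δ x a + indeg x ((b , c) ∷ A ++ B)   ≡⟨ cong (δ x a +_) (sym (sumBy-insert (λ e → δ x (proj₂ e)) A (a , c) B)) ⟩
    δ x a + indeg x (A ++ (a , c) ∷ B)   ∎
    where open ≡-Reasoning
  balanced-subdivide true a b c A B bal x = begin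
    δ x a + outdeg x (A ++ (c , a) ∷ B)  ≡⟨ cong (δ x a +_) (sumBy-insert (λ e → δ x (proj₁ e)) A (c , a) B) ⟩
    δ x a + outdeg x ((c , b) ∷ A ++ B)  ≡⟨ cong (δ x a +_) (bal x) ⟩
    δ x a + (δ x b + indeg x (A ++ B))   ≡⟨ x∙yz≈y∙xz (δ x a) (δ x b) _ ⟩
    δ x b + (δ x a + indeg x (A ++ B))   ≡⟨ cong (δ x b +_) (sym (sumBy-insert (λ e → δ x (proj₂ e)) A (c , a) B)) ⟩
    δ x b + indeg x (A ++ (c , a) ∷ B)   ∎
    where open ≡-Reasoning

  deg-insert : ∀ x A e B → deg x (A ++ e ∷ B) ≡ degArc x e + deg x (A ++ B)
  deg-insert x A e B
    rewrite sumBy-insert (λ e → δ x (proj₁ e)) A e B | sumBy-insert (λ e → δ x (proj₂ e)) A e B =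
    interchange (δ x (proj₁ e)) (outdeg x (A ++ B)) (δ x (proj₂ e)) (indeg x (A ++ B))

  record Incidence (a : V) (L : List (V × V)) : Set where
    field
      before after : List (V × V)
      arc : V × V
      L-split : L ≡ before ++ arc ∷ after
      flipped : Bool
      other : V
      arc-from-a : flipIf flipped arc ≡ (a , other)

  incidence : ∀ a L → deg a L ≢ 0 → Incidence a L
  incidence a [] deg≢0 = ⊥-elim (deg≢0 refl)
  incidence a ((u , v) ∷ L) deg≢0 = at (a ≟ u) (a ≟ v)
    where
    later : Incidence a L → Incidence a ((u , v) ∷ L)
    later i = record
      { before = (u , v) ∷ before ; after = after ; arc = arc ; L-split = cong ((u , v) ∷_) L-split
      ; flipped = flipped ; other = other ; arc-from-a = arc-from-a }
      where open Incidence i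
    at : Dec (a ≡ u) → Dec (a ≡ v) → Incidence a ((u , v) ∷ L)
    at (yes refl) _ = record
      { before = [] ; after = L ; arc = (u , v) ; L-split = refl ; flipped = false ; other = v ; arc-from-a = refl }
    at (no _) (yes refl) = record
      { before = [] ; after = L ; arc = (u , v) ; L-split = refl ; flipped = true ; other = u ; arc-from-a = refl }
    at (no a≢u) (no a≢v) = later (incidence a L λ eq → deg≢0 (begin
      deg a ((u , v) ∷ L)        ≡⟨ deg-∷ a (u , v) L ⟩
      δ a u + δ a v + deg a L    ≡⟨ cong₂ (λ p q → p + q + deg a L) (δ-≢ a≢u) (δ-≢ a≢v) ⟩
      deg a L                    ≡⟨ eq ⟩
      0                          ∎))
      where open ≡-Reasoning

  Orientation : List (V × V) → Set
  Orientation L = Σ (List Bool) λ bs → Balanced (orient L bs)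

  -- The recursion is on a fuel bound for the number of arcs: a non-loop arc a → b is merged with
  -- another arc at a (which exists since deg a is even) into a single arc, shortening the list.
  private
    orientation : ∀ fuel L → length L ≤ fuel → EvenDegrees L → Orientation L
    orientation-loop : ∀ fuel a L → length L ≤ fuel → EvenDegrees ((a , a) ∷ L) → Orientation ((a , a) ∷ L)
    orientation-arc : ∀ fuel a b L → a ≢ b → length L ≤ fuel → EvenDegrees ((a , b) ∷ L) → Orientation ((a , b) ∷ L)

  orientation fuel [] _ _ = [] , λ x → refl
  orientation (suc fuel) ((a , b) ∷ L) (s≤s len≤) even with a ≟ b
  ... | yes refl = orientation-loop fuel a L len≤ even
  ... | no a≢b = orientation-arc fuel a b L a≢b len≤ even

  orientation-loop fuel a L len≤ even with orientation fuel L len≤ even-L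
    where
    even-L : EvenDegrees L
    even-L x = Even-double+ (δ x a) (deg x L) (subst Even (deg-∷ x (a , a) L) (even x))
  ... | bs , bal = false ∷ bs , λ x → cong (δ x a +_) (bal x)

  orientation-arc fuel a b L a≢b len≤ even = merge (incidence a L deg≢0)
    where
    deg≢0 : deg a L ≢ 0
    deg≢0 = Even-suc⇒≢0 (deg a L) (subst Even deg-a (even a))
      where
      deg-a : deg a ((a , b) ∷ L) ≡ suc (deg a L)
      deg-a rewrite deg-∷ a (a , b) L | δ-refl a | δ-≢ a≢b = refl
    merge : Incidence a L → Orientation ((a , b) ∷ L)
    merge record { before = A ; after = B ; arc = e ; L-split = refl ; flipped = g ; other = c ; arc-from-a = e≡ac } =
      extend (orientation fuel N len-N even-N)
      where
      N : List (V × V)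
      N = (b , c) ∷ (A ++ B)
      len-N : length N ≤ fuel
      len-N = subst (_≤ fuel) (length-insert A e B) len≤
      deg-N : ∀ x → deg x ((a , b) ∷ (A ++ e ∷ B)) ≡ δ x a + δ x a + deg x N
      deg-N x rewrite deg-∷ x (a , b) (A ++ e ∷ B) | deg-insert x A e B | sym (degArc-flipIf x g e) | e≡ac
        | deg-∷ x (b , c) (A ++ B) = rearrange (δ x a) (δ x b) (δ x c) (deg x (A ++ B))
        where
        rearrange : ∀ p q r s → (p + q) + ((p + r) + s) ≡ p + p + ((q + r) + s)
        rearrange = solve-∀
      even-N : EvenDegrees N
      even-N x = Even-double+ (δ x a) (deg x N) (subst Even (deg-N x) (even x))
      extend : Orientation N → Orientation ((a , b) ∷ (A ++ e ∷ B))
      extend (bs , bal) = bits , balanced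
        where
        β : Bool
        β = hd bs
        bs′ : List Bool
        bs′ = tl bs
        bits : List Bool
        bits = not β ∷ (takeBits (length A) bs′ ++ (g xor β) ∷ dropBits (length A) bs′)
        balanced : Balanced (orient ((a , b) ∷ (A ++ e ∷ B)) bits)
        balanced rewrite orient-insert A e B bs′ (g xor β) | flipIf-xor β g e | e≡ac =
          balanced-subdivide β a b c (orient A bs′) (orient B (dropBits (length A) bs′))
            (subst (λ L → Balanced (flipIf β (b , c) ∷ L)) (orient-++ A B bs′) bal)

  eulerian-orientation : ∀ L → EvenDegrees L → Orientation L
  eulerian-orientation L = orientation (length L) L ≤-refl

-- One-factors of regular digraphs

2^[1+m]≡2^m+2^m : ∀ m → 2 ^ suc m ≡ 2 ^ m + 2 ^ m
2^[1+m]≡2^m+2^m m = cong (2 ^ m +_) (+-identityʳ (2 ^ m))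

m<2^m : ∀ m → m < 2 ^ m
m<2^m zero = s≤s z≤n
m<2^m (suc m) = begin-strict
  suc m          ≡⟨ +-comm 1 m ⟩
  m + 1          <⟨ +-mono-<-≤ (m<2^m m) (m^n>0 2 m) ⟩
  2 ^ m + 2 ^ m  ≡⟨ sym (2^[1+m]≡2^m+2^m m) ⟩
  2 ^ suc m      ∎
  where open ≤-Reasoning

module OneFactors (n : ℕ) where

  open Arcs (_≟_ {n})

  loops : List (Fin n × Fin n) → ℕ
  loops = sumBy (λ e → δ (proj₁ e) (proj₂ e))

  record OneFactor (D : List (Fin n × Fin n)) : Set where
    field
      arcs : List (Fin n × Fin n)
      outdeg≡1 : ∀ x → outdeg x arcs ≡ 1
      indeg≡1 : ∀ x → indeg x arcs ≡ 1
      ⊆D : ∀ {e} → e ∈ arcs → e ∈ D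

  -- The bipartite double cover: an arc x → y becomes an edge between the copies inj₁ x and inj₂ y.
  _≟⊎_ : DecidableEquality (Fin n ⊎ Fin n)
  _≟⊎_ = Sum.≡-dec _≟_ _≟_

  module Cover = Arcs _≟⊎_

  cover : Fin n × Fin n → (Fin n ⊎ Fin n) × (Fin n ⊎ Fin n)
  cover (x , y) = inj₁ x , inj₂ y

  δ-inj₁ : ∀ x y → Cover.δ (inj₁ x) (inj₁ y) ≡ δ x y
  δ-inj₁ x y = 𝟙-cong (inj₁ x ≟⊎ inj₁ y) (x ≟ y) Sum.inj₁-injective (cong inj₁)

  δ-inj₂ : ∀ x y → Cover.δ (inj₂ x) (inj₂ y) ≡ δ x y
  δ-inj₂ x y = 𝟙-cong (inj₂ x ≟⊎ inj₂ y) (x ≟ y) Sum.inj₂-injective (cong inj₂)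

  δ-inj₁₂ : ∀ x y → Cover.δ (inj₁ x) (inj₂ y) ≡ 0
  δ-inj₁₂ x y = Cover.δ-≢ {inj₁ x} {inj₂ y} λ ()

  δ-inj₂₁ : ∀ x y → Cover.δ (inj₂ x) (inj₁ y) ≡ 0
  δ-inj₂₁ x y = Cover.δ-≢ {inj₂ x} {inj₁ y} λ ()

  -- An orientation of the cover splits the arcs into those kept (bit false) and those reversed.
  splitByBits : List (Fin n × Fin n) → List Bool → List (Fin n × Fin n) × List (Fin n × Fin n)
  splitByBits [] bs = [] , []
  splitByBits (e ∷ P) bs with hd bs | splitByBits P (tl bs)
  ... | false | P₁ , P₂ = e ∷ P₁ , P₂
  ... | true  | P₁ , P₂ = P₁ , e ∷ P₂

  sumBy-splitByBits : (w : Fin n × Fin n → ℕ) (P : List (Fin n × Fin n)) (bs : List Bool) →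
    sumBy w (proj₁ (splitByBits P bs)) + sumBy w (proj₂ (splitByBits P bs)) ≡ sumBy w P
  sumBy-splitByBits w [] bs = refl
  sumBy-splitByBits w (e ∷ P) bs with hd bs | splitByBits P (tl bs) | sumBy-splitByBits w P (tl bs)
  ... | false | P₁ , P₂ | eq = trans (+-assoc (w e) _ _) (cong (w e +_) eq)
  ... | true  | P₁ , P₂ | eq = trans (x∙yz≈y∙xz (sumBy w P₁) (w e) _) (cong (w e +_) eq)

  ∈-splitByBits₁ : ∀ P bs {e} → e ∈ proj₁ (splitByBits P bs) → e ∈ P
  ∈-splitByBits₁ (x ∷ P) bs e∈ with hd bs | splitByBits P (tl bs) | ∈-splitByBits₁ P (tl bs)
  ... | false | P₁ , P₂ | rec with e∈
  ...   | here p = here p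
  ...   | there e∈′ = there (rec e∈′)
  ∈-splitByBits₁ (x ∷ P) bs e∈ | true  | P₁ , P₂ | rec = there (rec e∈)

  ∈-splitByBits₂ : ∀ P bs {e} → e ∈ proj₂ (splitByBits P bs) → e ∈ P
  ∈-splitByBits₂ (x ∷ P) bs e∈ with hd bs | splitByBits P (tl bs) | ∈-splitByBits₂ P (tl bs)
  ... | false | P₁ , P₂ | rec = there (rec e∈)
  ... | true  | P₁ , P₂ | rec with e∈
  ...   | here p = here p
  ...   | there e∈′ = there (rec e∈′)

  outdeg₁-cover : ∀ x P bs → Cover.outdeg (inj₁ x) (orient (map cover P) bs) ≡ outdeg x (proj₁ (splitByBits P bs))
  outdeg₁-cover x [] bs = refl
  outdeg₁-cover x ((u , v) ∷ P) bs with hd bs | splitByBits P (tl bs) | outdeg₁-cover x P (tl bs)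
  ... | false | P₁ , P₂ | eq = cong₂ _+_ (δ-inj₁ x u) eq
  ... | true  | P₁ , P₂ | eq = cong₂ _+_ (δ-inj₁₂ x v) eq

  indeg₁-cover : ∀ x P bs → Cover.indeg (inj₁ x) (orient (map cover P) bs) ≡ outdeg x (proj₂ (splitByBits P bs))
  indeg₁-cover x [] bs = refl
  indeg₁-cover x ((u , v) ∷ P) bs with hd bs | splitByBits P (tl bs) | indeg₁-cover x P (tl bs)
  ... | false | P₁ , P₂ | eq = cong₂ _+_ (δ-inj₁₂ x v) eq
  ... | true  | P₁ , P₂ | eq = cong₂ _+_ (δ-inj₁ x u) eq

  indeg₂-cover : ∀ y P bs → Cover.indeg (inj₂ y) (orient (map cover P) bs) ≡ indeg y (proj₁ (splitByBits P bs))
  indeg₂-cover y [] bs = refl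
  indeg₂-cover y ((u , v) ∷ P) bs with hd bs | splitByBits P (tl bs) | indeg₂-cover y P (tl bs)
  ... | false | P₁ , P₂ | eq = cong₂ _+_ (δ-inj₂ y v) eq
  ... | true  | P₁ , P₂ | eq = cong₂ _+_ (δ-inj₂₁ y u) eq

  outdeg₂-cover : ∀ y P bs → Cover.outdeg (inj₂ y) (orient (map cover P) bs) ≡ indeg y (proj₂ (splitByBits P bs))
  outdeg₂-cover y [] bs = refl
  outdeg₂-cover y ((u , v) ∷ P) bs with hd bs | splitByBits P (tl bs) | outdeg₂-cover y P (tl bs)
  ... | false | P₁ , P₂ | eq = cong₂ _+_ (δ-inj₂₁ y u) eq
  ... | true  | P₁ , P₂ | eq = cong₂ _+_ (δ-inj₂ y v) eq

  deg₁-cover : ∀ x P → Cover.deg (inj₁ x) (map cover P) ≡ outdeg x P + 0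
  deg₁-cover x P = cong₂ _+_
    (trans (sumBy-map _ cover P) (sumBy-cong P (λ e → δ-inj₁ x (proj₁ e))))
    (trans (sumBy-map _ cover P) (trans (sumBy-cong P (λ e → δ-inj₁₂ x (proj₂ e))) (sumBy-zero P)))

  deg₂-cover : ∀ y P → Cover.deg (inj₂ y) (map cover P) ≡ 0 + indeg y P
  deg₂-cover y P = cong₂ _+_
    (trans (sumBy-map _ cover P) (trans (sumBy-cong P (λ e → δ-inj₂₁ y (proj₁ e))) (sumBy-zero P)))
    (trans (sumBy-map _ cover P) (sumBy-cong P (λ e → δ-inj₂ y (proj₂ e))))

  Diregular : ℕ → List (Fin n × Fin n) → Set
  Diregular d P = (∀ x → outdeg x P ≡ d) × (∀ x → indeg x P ≡ d)

  record Halving (d : ℕ) (P : List (Fin n × Fin n)) : Set where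
    field
      P₁ P₂ : List (Fin n × Fin n)
      regular₁ : Diregular d P₁
      regular₂ : Diregular d P₂
      loops-+ : loops P₁ + loops P₂ ≡ loops P
      ⊆P₁ : ∀ {e} → e ∈ P₁ → e ∈ P
      ⊆P₂ : ∀ {e} → e ∈ P₂ → e ∈ P

  -- In an Eulerian orientation of the double cover, the kept and the reversed arcs each have
  -- in- and out-degree d at every vertex.
  halve : ∀ d P → Diregular (d + d) P → Halving d P
  halve d P (out≡ , in≡) = record
    { P₁ = P₁ ; P₂ = P₂
    ; regular₁ = (λ x → half (out-equal x) (out-sum x)) , (λ y → half (in-equal y) (in-sum y))
    ; regular₂ = (λ x → half (sym (out-equal x)) (trans (+-comm (outdeg x P₂) _) (out-sum x)))
               , (λ y → half (sym (in-equal y)) (trans (+-comm (indeg y P₂) _) (in-sum y)))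
    ; loops-+ = sumBy-splitByBits _ P bits
    ; ⊆P₁ = ∈-splitByBits₁ P bits ; ⊆P₂ = ∈-splitByBits₂ P bits }
    where
    even : Cover.EvenDegrees (map cover P)
    even (inj₁ x) = subst Even (sym (trans (deg₁-cover x P) (trans (+-identityʳ _) (out≡ x)))) (Even-double d)
    even (inj₂ y) = subst Even (sym (trans (deg₂-cover y P) (in≡ y))) (Even-double d)
    orientation : Cover.Orientation (map cover P)
    orientation = Cover.eulerian-orientation (map cover P) even
    bits : List Bool
    bits = proj₁ orientation
    P₁ P₂ : List (Fin n × Fin n)
    P₁ = proj₁ (splitByBits P bits)
    P₂ = proj₂ (splitByBits P bits)
    out-equal : ∀ x → outdeg x P₁ ≡ outdeg x P₂
    out-equal x = trans (sym (outdeg₁-cover x P bits)) (trans (proj₂ orientation (inj₁ x)) (indeg₁-cover x P bits))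
    in-equal : ∀ y → indeg y P₁ ≡ indeg y P₂
    in-equal y = trans (sym (indeg₂-cover y P bits)) (trans (sym (proj₂ orientation (inj₂ y))) (outdeg₂-cover y P bits))
    out-sum : ∀ x → outdeg x P₁ + outdeg x P₂ ≡ d + d
    out-sum x = trans (sumBy-splitByBits _ P bits) (out≡ x)
    in-sum : ∀ y → indeg y P₁ + indeg y P₂ ≡ d + d
    in-sum y = trans (sumBy-splitByBits _ P bits) (in≡ y)
    half : ∀ {a b} → a ≡ b → a + b ≡ d + d → a ≡ d
    half {a} refl = m+m≡n+n⇒m≡n a d

  LightOneFactor : ℕ → List (Fin n × Fin n) → Set
  LightOneFactor j P = Σ (OneFactor P) λ Q → loops (OneFactor.arcs Q) * 2 ^ j ≤ loops P

  lighterHalf : ∀ {j P P′ P″} → (∀ {e} → e ∈ P′ → e ∈ P) → loops P′ ≤ loops P″ → loops P′ + loops P″ ≡ loops P →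
    LightOneFactor j P′ → LightOneFactor (suc j) P
  lighterHalf {j} {P} {P′} {P″} ⊆P ≤″ sum (Q , bound) =
    record { arcs = arcs ; outdeg≡1 = outdeg≡1 ; indeg≡1 = indeg≡1 ; ⊆D = λ e∈ → ⊆P (⊆D e∈) } , (begin
      loops arcs * 2 ^ suc j                    ≡⟨ cong (loops arcs *_) (2^[1+m]≡2^m+2^m j) ⟩
      loops arcs * (2 ^ j + 2 ^ j)              ≡⟨ *-distribˡ-+ (loops arcs) (2 ^ j) (2 ^ j) ⟩
      loops arcs * 2 ^ j + loops arcs * 2 ^ j   ≤⟨ +-mono-≤ bound (≤-trans bound ≤″) ⟩
      loops P′ + loops P″                       ≡⟨ sum ⟩
      loops P                                   ∎)
    where
    open OneFactor Q
    open ≤-Reasoning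

  -- Halve j times, each time keeping the half with fewer loops.
  lightOneFactor : ∀ j P → Diregular (2 ^ j) P → LightOneFactor j P
  lightOneFactor zero P (out≡ , in≡) =
    record { arcs = P ; outdeg≡1 = out≡ ; indeg≡1 = in≡ ; ⊆D = λ e∈ → e∈ } , ≤-reflexive (*-identityʳ (loops P))
  lightOneFactor (suc j) P (out≡ , in≡) = fromHalving (halve (2 ^ j) P (out≡′ , in≡′))
    where
    out≡′ : ∀ x → outdeg x P ≡ 2 ^ j + 2 ^ j
    out≡′ x = trans (out≡ x) (2^[1+m]≡2^m+2^m j)
    in≡′ : ∀ x → indeg x P ≡ 2 ^ j + 2 ^ j
    in≡′ x = trans (in≡ x) (2^[1+m]≡2^m+2^m j)
    fromHalving : Halving (2 ^ j) P → LightOneFactor (suc j) P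
    fromHalving h = keepLighter (loops P₁ ≤? loops P₂)
      where
      open Halving h
      keepLighter : Dec (loops P₁ ≤ loops P₂) → LightOneFactor (suc j) P
      keepLighter (yes ₁≤₂) = lighterHalf {j} {P} {P₁} {P₂} ⊆P₁ ₁≤₂ loops-+ (lightOneFactor j P₁ regular₁)
      keepLighter (no ₁≰₂) = lighterHalf {j} {P} {P₂} {P₁} ⊆P₂ (<⇒≤ (≰⇒> ₁≰₂)) (trans (+-comm (loops P₂) (loops P₁)) loops-+)
        (lightOneFactor j P₂ regular₂)

  diagonal : List (Fin n × Fin n)
  diagonal = map (λ z → z , z) (allFin n)

  sumBy-δ-allFin≡1 : ∀ x → sumBy (λ z → δ x z) (allFin n) ≡ 1
  sumBy-δ-allFin≡1 x = trans (sumBy-cong (allFin n) (λ z → sym (*-identityʳ (δ x z)))) (sumBy-allFin-δ x (λ _ → 1))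

  outdeg-diagonal : ∀ x → outdeg x diagonal ≡ 1
  outdeg-diagonal x = trans (sumBy-map _ (λ z → z , z) (allFin n)) (sumBy-δ-allFin≡1 x)

  indeg-diagonal : ∀ x → indeg x diagonal ≡ 1
  indeg-diagonal x = trans (sumBy-map _ (λ z → z , z) (allFin n)) (sumBy-δ-allFin≡1 x)

  loops-diagonal : loops diagonal ≡ n
  loops-diagonal = begin
    loops diagonal                 ≡⟨ sumBy-map _ (λ z → z , z) (allFin n) ⟩
    sumBy (λ z → δ z z) (allFin n) ≡⟨ sumBy-cong (allFin n) δ-refl ⟩
    sumBy (λ _ → 1) (allFin n)     ≡⟨ sym (length≡sumBy1 (allFin n)) ⟩
    length (allFin n)              ≡⟨ length-tabulate (λ i → i) ⟩
    n                              ∎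
    where open ≡-Reasoning

  loop∈⇒1≤loops : ∀ Q z → (z , z) ∈ Q → 1 ≤ loops Q
  loop∈⇒1≤loops Q z z∈ = ≤-trans (≤-reflexive (sym (δ-refl z))) (∈⇒≤sumBy _ Q z∈)

  -- Alon's trick: with t = k n and 2^t = α k + β (β < k), α copies of D together with β copies
  -- of the diagonal are 2^t-regular and have β n < 2^t loops, so a light one-factor has no loop.
  oneFactor : ∀ k D → Diregular (suc k) D → loops D ≡ 0 → OneFactor D
  oneFactor k′ D (out≡ , in≡) loops≡0 = record
    { arcs = arcs ; outdeg≡1 = outdeg≡1 ; indeg≡1 = indeg≡1 ; ⊆D = avoid-diagonal }
    where
    k t α β : ℕ
    k = suc k′
    t = k * n
    α = 2 ^ t / k
    β = 2 ^ t % k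
    P : List (Fin n × Fin n)
    P = repeat α D ++ repeat β diagonal
    sumBy-P : (w : Fin n × Fin n → ℕ) → sumBy w P ≡ α * sumBy w D + β * sumBy w diagonal
    sumBy-P w = trans (sumBy-++ w (repeat α D) (repeat β diagonal)) (cong₂ _+_ (sumBy-repeat w α D) (sumBy-repeat w β diagonal))
    regular-P : (w : Fin n × Fin n → ℕ) → sumBy w D ≡ k → sumBy w diagonal ≡ 1 → sumBy w P ≡ 2 ^ t
    regular-P w w-D w-diagonal = begin
      sumBy w P                                   ≡⟨ sumBy-P w ⟩
      α * sumBy w D + β * sumBy w diagonal        ≡⟨ cong₂ (λ a b → α * a + β * b) w-D w-diagonal ⟩
      α * k + β * 1                               ≡⟨ cong (α * k +_) (*-identityʳ β) ⟩
      α * k + β                                   ≡⟨ trans (+-comm (α * k) β) (sym (m≡m%n+[m/n]*n (2 ^ t) k)) ⟩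
      2 ^ t                                       ∎
      where open ≡-Reasoning
    light : LightOneFactor t P
    light = lightOneFactor t P
      ((λ x → regular-P _ (out≡ x) (outdeg-diagonal x)) , (λ x → regular-P _ (in≡ x) (indeg-diagonal x)))
    open OneFactor (proj₁ light)
    loops-P<2^t : loops P < 2 ^ t
    loops-P<2^t = begin-strict
      loops P                               ≡⟨ sumBy-P _ ⟩
      α * loops D + β * loops diagonal      ≡⟨ cong₂ (λ a b → α * a + β * b) loops≡0 loops-diagonal ⟩
      α * 0 + β * n                         ≡⟨ cong (_+ β * n) (*-zeroʳ α) ⟩
      β * n                                 ≤⟨ *-monoˡ-≤ n (<⇒≤ (m%n<n (2 ^ t) k)) ⟩
      t                                     <⟨ m<2^m t ⟩
      2 ^ t                                 ∎
      where open ≤-Reasoning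
    no-loops : loops arcs ≡ 0
    no-loops with loops arcs | ≤-<-trans (proj₂ light) loops-P<2^t
    ... | zero  | _ = refl
    ... | suc l | too-many = ⊥-elim (<⇒≱ too-many (m≤m+n (2 ^ t) (l * 2 ^ t)))
    avoid-diagonal : ∀ {e} → e ∈ arcs → e ∈ D
    avoid-diagonal e∈ with ∈-++⁻ (repeat α D) (⊆D e∈)
    ... | inj₁ e∈D = ∈-repeat α D e∈D
    ... | inj₂ e∈diagonal with ∈-map⁻ (λ z → z , z) (∈-repeat β diagonal e∈diagonal)
    ...   | z , _ , refl with subst (1 ≤_) no-loops (loop∈⇒1≤loops arcs z e∈)
    ...     | ()

  record ArcPermutation (D : List (Fin n × Fin n)) : Set where
    field
      φ ψ : Fin n → Fin n
      φ∘ψ : ∀ y → φ (ψ y) ≡ y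
      ψ∘φ : ∀ x → ψ (φ x) ≡ x
      φ-arc : ∀ x → (x , φ x) ∈ D

  oneFactor⇒permutation : ∀ {D} → OneFactor D → ArcPermutation D
  oneFactor⇒permutation Q = record
    { φ = φ ; ψ = ψ
    ; φ∘ψ = λ y → successor-unique (ψ y) arcs (≤-reflexive (outdeg≡1 (ψ y))) (proj₂ (φ′ (ψ y))) (proj₂ (ψ′ y))
    ; ψ∘φ = λ x → predecessor-unique (φ x) arcs (≤-reflexive (indeg≡1 (φ x))) (proj₂ (ψ′ (φ x))) (proj₂ (φ′ x))
    ; φ-arc = λ x → ⊆D (proj₂ (φ′ x)) }
    where
    open OneFactor Q
    φ′ : ∀ x → Σ (Fin n) λ y → (x , y) ∈ arcs
    φ′ x = successor x arcs (λ eq → 1+n≢0 (trans (sym (outdeg≡1 x)) eq))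
    ψ′ : ∀ y → Σ (Fin n) λ x → (x , y) ∈ arcs
    ψ′ y = predecessor y arcs (λ eq → 1+n≢0 (trans (sym (indeg≡1 y)) eq))
    φ ψ : Fin n → Fin n
    φ x = proj₁ (φ′ x)
    ψ y = proj₁ (ψ′ y)

-- Orienting the graph

module GraphOrientation {n : ℕ} (G : Graph n) where

  open Arcs (_≟_ {n})
  open OneFactors n

  adj-sym : ∀ {x y} → Adj G x y → Adj G y x
  adj-sym {x} {y} x~y = trans (Graph.sym G y x) x~y

  adj⇒≢ : ∀ {x y} → Adj G x y → x ≢ y
  adj⇒≢ {x} x~x refl with trans (sym x~x) (Graph.irrefl G x)
  ... | ()

  adj? : ∀ x y → Dec (Adj G x y)
  adj? x y = adj G x y ≟ᵇ true

  ArcsAdjacent : List (Fin n × Fin n) → Set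
  ArcsAdjacent L = ∀ {e} → e ∈ L → Adj G (proj₁ e) (proj₂ e)

  multiplicity : Fin n → Fin n → Fin n × Fin n → ℕ
  multiplicity x y e = 𝟙 (sameEdge? x y e)

  multiplicity-swap : ∀ x y e → multiplicity x y (swap e) ≡ multiplicity x y e
  multiplicity-swap x y e = 𝟙-cong (sameEdge? x y (swap e)) (sameEdge? x y e) flip′ flip′
    where
    flip′ : ∀ {e′} → SameEdge x y e′ → SameEdge x y (swap e′)
    flip′ (inj₁ (p , q)) = inj₂ (q , p)
    flip′ (inj₂ (p , q)) = inj₁ (q , p)

  multiplicity≡δδ : ∀ {x y} → x ≢ y → ∀ e →
    multiplicity x y e ≡ δ x (proj₁ e) * δ y (proj₂ e) + δ y (proj₁ e) * δ x (proj₂ e)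
  multiplicity≡δδ {x} {y} x≢y (a , b) with x ≟ a | y ≟ b | y ≟ a | x ≟ b
  ... | yes refl | yes refl | yes y≡x | _        = ⊥-elim (x≢y (sym y≡x))
  ... | yes refl | yes refl | no _    | yes x≡y  = ⊥-elim (x≢y x≡y)
  ... | yes refl | yes refl | no _    | no _     = 𝟙-yes (sameEdge? x y (x , y)) (inj₁ (refl , refl))
  ... | yes refl | no b≢y   | yes y≡x | _        = ⊥-elim (x≢y (sym y≡x))
  ... | yes refl | no b≢y   | no _    | _        =
    𝟙-no (sameEdge? x y (x , b)) λ { (inj₁ (_ , b≡y)) → b≢y (sym b≡y) ; (inj₂ (x≡y , _)) → x≢y x≡y }
  ... | no _     | _        | yes refl | yes refl = 𝟙-yes (sameEdge? x y (y , x)) (inj₂ (refl , refl))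
  ... | no _     | _        | yes refl | no b≢x  =
    𝟙-no (sameEdge? x y (y , b)) λ { (inj₁ (y≡x , _)) → x≢y (sym y≡x) ; (inj₂ (_ , b≡x)) → b≢x (sym b≡x) }
  ... | no a≢x   | _        | no a≢y   | _       =
    𝟙-no (sameEdge? x y (a , b)) λ { (inj₁ (a≡x , _)) → a≢x (sym a≡x) ; (inj₂ (a≡y , _)) → a≢y (sym a≡y) }

  allPairs : List (Fin n × Fin n)
  allPairs = concatMap (λ a → map (a ,_) (allFin n)) (allFin n)

  sumBy-allPairs : (w : Fin n × Fin n → ℕ) →
    sumBy w allPairs ≡ sumBy (λ a → sumBy (λ b → w (a , b)) (allFin n)) (allFin n)
  sumBy-allPairs w =
    trans (sumBy-concatMap w _ (allFin n)) (sumBy-cong (allFin n) (λ a → sumBy-map w (a ,_) (allFin n)))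

  sumBy-allPairs-from : (W : Fin n × Fin n → ℕ) (v : Fin n) →
    sumBy (λ e → W e * δ v (proj₁ e)) allPairs ≡ sumBy (λ b → W (v , b)) (allFin n)
  sumBy-allPairs-from W v = begin
    sumBy (λ e → W e * δ v (proj₁ e)) allPairs
      ≡⟨ sumBy-allPairs _ ⟩
    sumBy (λ a → sumBy (λ b → W (a , b) * δ v a) (allFin n)) (allFin n)
      ≡⟨ sumBy-cong (allFin n) (λ a → trans (sumBy-cong (allFin n) (λ b → *-comm (W (a , b)) (δ v a)))
                                           (sumBy-*ˡ (δ v a) (λ b → W (a , b)) (allFin n))) ⟩
    sumBy (λ a → δ v a * sumBy (λ b → W (a , b)) (allFin n)) (allFin n)
      ≡⟨ sumBy-allFin-δ v _ ⟩
    sumBy (λ b → W (v , b)) (allFin n) ∎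
    where open ≡-Reasoning

  sumBy-allPairs-to : (W : Fin n × Fin n → ℕ) (v : Fin n) →
    sumBy (λ e → W e * δ v (proj₂ e)) allPairs ≡ sumBy (λ a → W (a , v)) (allFin n)
  sumBy-allPairs-to W v = begin
    sumBy (λ e → W e * δ v (proj₂ e)) allPairs
      ≡⟨ sumBy-allPairs _ ⟩
    sumBy (λ a → sumBy (λ b → W (a , b) * δ v b) (allFin n)) (allFin n)
      ≡⟨ sumBy-cong (allFin n) (λ a → trans (sumBy-cong (allFin n) (λ b → *-comm (W (a , b)) (δ v b)))
                                           (sumBy-allFin-δ v (λ b → W (a , b)))) ⟩
    sumBy (λ a → W (a , v)) (allFin n) ∎
    where open ≡-Reasoning

  sumBy-allPairs-at : (W : Fin n × Fin n → ℕ) (x y : Fin n) →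
    sumBy (λ e → W e * (δ x (proj₁ e) * δ y (proj₂ e))) allPairs ≡ W (x , y)
  sumBy-allPairs-at W x y = begin
    sumBy (λ e → W e * (δ x (proj₁ e) * δ y (proj₂ e))) allPairs
      ≡⟨ sumBy-cong allPairs (λ e → trans (cong (W e *_) (*-comm (δ x (proj₁ e)) _)) (sym (*-assoc (W e) _ _))) ⟩
    sumBy (λ e → (W e * δ y (proj₂ e)) * δ x (proj₁ e)) allPairs
      ≡⟨ sumBy-allPairs-from (λ e → W e * δ y (proj₂ e)) x ⟩
    sumBy (λ b → W (x , b) * δ y b) (allFin n)
      ≡⟨ sumBy-cong (allFin n) (λ b → *-comm (W (x , b)) (δ y b)) ⟩
    sumBy (λ b → δ y b * W (x , b)) (allFin n)
      ≡⟨ sumBy-allFin-δ y _ ⟩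
    W (x , y) ∎
    where open ≡-Reasoning

  Forward : Fin n × Fin n → Set
  Forward (x , y) = Adj G x y × toℕ x < toℕ y

  forward? : ∀ e → Dec (Forward e)
  forward? (x , y) = adj? x y ×-dec (toℕ x <? toℕ y)

  edges : List (Fin n × Fin n)
  edges = filter forward? allPairs

  forward-one-way : ∀ {x y} → Adj G x y → 𝟙 (forward? (x , y)) + 𝟙 (forward? (y , x)) ≡ 1
  forward-one-way {x} {y} x~y with <-cmp (toℕ x) (toℕ y)
  ... | tri< x<y _ x≯y = cong₂ _+_ (𝟙-yes (forward? (x , y)) (x~y , x<y)) (𝟙-no (forward? (y , x)) (λ f → x≯y (proj₂ f)))
  ... | tri≈ _ x≡y _ = ⊥-elim (adj⇒≢ x~y (toℕ-injective x≡y))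
  ... | tri> x≮y _ x>y = cong₂ _+_ (𝟙-no (forward? (x , y)) (λ f → x≮y (proj₂ f))) (𝟙-yes (forward? (y , x)) (adj-sym x~y , x>y))

  edges-adjacent : ArcsAdjacent edges
  edges-adjacent e∈ = proj₁ (proj₂ (∈-filter⁻ forward? {xs = allPairs} e∈))

  deg-edges : ∀ v → deg v edges ≡ degree G v
  deg-edges v = begin
    outdeg v edges + indeg v edges
      ≡⟨ cong₂ _+_ (trans (sumBy-filter forward? _ allPairs) (sumBy-allPairs-from (λ e → 𝟙 (forward? e)) v))
                   (trans (sumBy-filter forward? _ allPairs) (sumBy-allPairs-to (λ e → 𝟙 (forward? e)) v)) ⟩
    sumBy (λ b → 𝟙 (forward? (v , b))) (allFin n) + sumBy (λ a → 𝟙 (forward? (a , v))) (allFin n)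
      ≡⟨ sym (sumBy-+ _ _ (allFin n)) ⟩
    sumBy (λ b → 𝟙 (forward? (v , b)) + 𝟙 (forward? (b , v))) (allFin n)
      ≡⟨ sumBy-cong (allFin n) (λ b → either-way b (adj? v b)) ⟩
    sumBy (λ b → 𝟙 (adj? v b)) (allFin n)
      ≡⟨ sym (length-filter≡sumBy𝟙 (adj? v) (allFin n)) ⟩
    degree G v ∎
    where
    open ≡-Reasoning
    either-way : ∀ b (v~b? : Dec (Adj G v b)) → 𝟙 (forward? (v , b)) + 𝟙 (forward? (b , v)) ≡ 𝟙 v~b?
    either-way b (yes v~b) = forward-one-way v~b
    either-way b (no v≁b) =
      cong₂ _+_ (𝟙-no (forward? (v , b)) (λ f → v≁b (proj₁ f))) (𝟙-no (forward? (b , v)) (λ f → v≁b (adj-sym (proj₁ f))))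

  edges-cover : ∀ {x y} → Adj G x y → sumBy (multiplicity x y) edges ≡ 1
  edges-cover {x} {y} x~y = begin
    sumBy (multiplicity x y) edges
      ≡⟨ sumBy-filter forward? _ allPairs ⟩
    sumBy (λ e → F e * multiplicity x y e) allPairs
      ≡⟨ sumBy-cong allPairs (λ e → trans (cong (F e *_) (multiplicity≡δδ (adj⇒≢ x~y) e)) (*-distribˡ-+ (F e) _ _)) ⟩
    sumBy (λ e → F e * (δ x (proj₁ e) * δ y (proj₂ e)) + F e * (δ y (proj₁ e) * δ x (proj₂ e))) allPairs
      ≡⟨ sumBy-+ _ _ allPairs ⟩
    sumBy (λ e → F e * (δ x (proj₁ e) * δ y (proj₂ e))) allPairs + sumBy (λ e → F e * (δ y (proj₁ e) * δ x (proj₂ e))) allPairs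
      ≡⟨ cong₂ _+_ (sumBy-allPairs-at F x y) (sumBy-allPairs-at F y x) ⟩
    F (x , y) + F (y , x)
      ≡⟨ forward-one-way x~y ⟩
    1 ∎
    where
    open ≡-Reasoning
    F : Fin n × Fin n → ℕ
    F e = 𝟙 (forward? e)

  adjacent⇒loops≡0 : ∀ L → ArcsAdjacent L → loops L ≡ 0
  adjacent⇒loops≡0 L adjacent = trans (sumBy-cong-∈ L (λ e e∈ → δ-≢ (adj⇒≢ (adjacent e∈)))) (sumBy-zero L)

  orient-adjacent : ∀ L bs → ArcsAdjacent L → ArcsAdjacent (orient L bs)
  orient-adjacent L bs adjacent e∈ with ∈-orient L bs e∈
  ... | e′ , e′∈ , inj₁ refl = adjacent e′∈
  ... | e′ , e′∈ , inj₂ refl = adj-sym (adjacent e′∈)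

  record Skeleton (k : ℕ) : Set where
    field
      arcs : List (Fin n × Fin n)
      arcs-adjacent : ArcsAdjacent arcs
      arcs-cover : ∀ {x y} → Adj G x y → sumBy (multiplicity x y) arcs ≡ 1
      excess : Fin n → ℕ
      excess≤1 : ∀ x → excess x ≤ 1
      outdeg-arcs : ∀ x → outdeg x arcs ≡ k + excess x
      centres : ArcPermutation arcs

  module Matching (m : Fin n → Fin n) (m-invol : ∀ v → m (m v) ≡ v) (m-adj : ∀ v → Adj G v (m v)) where

    matched? : ∀ e → Dec (proj₂ e ≡ m (proj₁ e))
    matched? e = proj₂ e ≟ m (proj₁ e)

    matchingArcs otherArcs : List (Fin n × Fin n)
    matchingArcs = filter matched? edges
    otherArcs = filter (λ e → ¬? (matched? e)) edges

    sumBy-matchingArcs : (w : Fin n × Fin n → ℕ) →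
      sumBy w matchingArcs ≡ sumBy (λ e → (𝟙 (forward? e) * 𝟙 (matched? e)) * w e) allPairs
    sumBy-matchingArcs w = trans (sumBy-filter matched? w edges) (trans (sumBy-filter forward? _ allPairs)
      (sumBy-cong allPairs (λ e → sym (*-assoc (𝟙 (forward? e)) (𝟙 (matched? e)) (w e)))))

    outdeg-matchingArcs : ∀ v → outdeg v matchingArcs ≡ 𝟙 (forward? (v , m v))
    outdeg-matchingArcs v = begin
      outdeg v matchingArcs
        ≡⟨ sumBy-matchingArcs _ ⟩
      sumBy (λ e → (𝟙 (forward? e) * 𝟙 (matched? e)) * δ v (proj₁ e)) allPairs
        ≡⟨ sumBy-allPairs-from (λ e → 𝟙 (forward? e) * 𝟙 (matched? e)) v ⟩
      sumBy (λ b → 𝟙 (forward? (v , b)) * 𝟙 (b ≟ m v)) (allFin n)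
        ≡⟨ sumBy-cong (allFin n) (λ b → trans (*-comm (𝟙 (forward? (v , b))) _)
                                             (cong (_* 𝟙 (forward? (v , b))) (δ-sym b (m v)))) ⟩
      sumBy (λ b → δ (m v) b * 𝟙 (forward? (v , b))) (allFin n)
        ≡⟨ sumBy-allFin-δ (m v) _ ⟩
      𝟙 (forward? (v , m v)) ∎
      where open ≡-Reasoning

    indeg-matchingArcs : ∀ v → indeg v matchingArcs ≡ 𝟙 (forward? (m v , v))
    indeg-matchingArcs v = begin
      indeg v matchingArcs
        ≡⟨ sumBy-matchingArcs _ ⟩
      sumBy (λ e → (𝟙 (forward? e) * 𝟙 (matched? e)) * δ v (proj₂ e)) allPairs
        ≡⟨ sumBy-allPairs-to (λ e → 𝟙 (forward? e) * 𝟙 (matched? e)) v ⟩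
      sumBy (λ a → 𝟙 (forward? (a , v)) * 𝟙 (v ≟ m a)) (allFin n)
        ≡⟨ sumBy-cong (allFin n) (λ a → trans (*-comm (𝟙 (forward? (a , v))) _)
             (cong (_* 𝟙 (forward? (a , v))) (𝟙-cong (v ≟ m a) (m v ≟ a)
               (λ v≡ma → trans (cong m v≡ma) (m-invol a)) (λ mv≡a → trans (sym (m-invol v)) (cong m mv≡a))))) ⟩
      sumBy (λ a → δ (m v) a * 𝟙 (forward? (a , v))) (allFin n)
        ≡⟨ sumBy-allFin-δ (m v) _ ⟩
      𝟙 (forward? (m v , v)) ∎
      where open ≡-Reasoning

    deg-matchingArcs : ∀ v → deg v matchingArcs ≡ 1
    deg-matchingArcs v = trans (cong₂ _+_ (outdeg-matchingArcs v) (indeg-matchingArcs v)) (forward-one-way (m-adj v))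

    deg-otherArcs : ∀ k → Regular G (suc (k + k)) → ∀ v → deg v otherArcs ≡ k + k
    deg-otherArcs k regular v = suc-injective (begin
      1 + deg v otherArcs                    ≡⟨ cong (_+ deg v otherArcs) (sym (deg-matchingArcs v)) ⟩
      deg v matchingArcs + deg v otherArcs   ≡⟨ interchange (outdeg v matchingArcs) (indeg v matchingArcs) _ _ ⟩
      (outdeg v matchingArcs + outdeg v otherArcs) + (indeg v matchingArcs + indeg v otherArcs)
        ≡⟨ cong₂ _+_ (sumBy-partition matched? _ edges) (sumBy-partition matched? _ edges) ⟩
      deg v edges                            ≡⟨ deg-edges v ⟩
      degree G v                             ≡⟨ regular v ⟩
      suc (k + k)                            ∎)
      where open ≡-Reasoning

    matchingArcs-adjacent : ArcsAdjacent matchingArcs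
    matchingArcs-adjacent e∈ = edges-adjacent (proj₁ (∈-filter⁻ matched? {xs = edges} e∈))

    otherArcs-adjacent : ArcsAdjacent otherArcs
    otherArcs-adjacent e∈ = edges-adjacent (proj₁ (∈-filter⁻ (λ e → ¬? (matched? e)) {xs = edges} e∈))

  skeleton : ∀ k → Regular G (2 * suc k + 1) → HasPerfectMatching G → Skeleton (suc k)
  skeleton k′ regular (m , m-invol , m-adj) = record
    { arcs = D ++ matchingArcs
    ; arcs-adjacent = arcs-adjacent
    ; arcs-cover = arcs-cover
    ; excess = λ x → outdeg x matchingArcs
    ; excess≤1 = λ x → subst (_≤ 1) (sym (outdeg-matchingArcs x)) (𝟙≤1 (forward? (x , m x)))
    ; outdeg-arcs = λ x → trans (sumBy-++ _ D matchingArcs) (cong (_+ outdeg x matchingArcs) (outdeg-D x))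
    ; centres = record { ArcPermutation centres-D ; φ-arc = λ x → ∈-++⁺ˡ (ArcPermutation.φ-arc centres-D x) } }
    where
    open Matching m m-invol m-adj
    k : ℕ
    k = suc k′
    even : EvenDegrees otherArcs
    regular′ : Regular G (suc (k + k))
    regular′ v = trans (regular v) (2k+1≡1+k+k k)
      where
      2k+1≡1+k+k : ∀ k → 2 * k + 1 ≡ suc (k + k)
      2k+1≡1+k+k = solve-∀
    even v = subst Even (sym (deg-otherArcs k regular′ v)) (Even-double k)
    eulerian : Orientation otherArcs
    eulerian = eulerian-orientation otherArcs even
    D : List (Fin n × Fin n)
    D = orient otherArcs (proj₁ eulerian)
    outdeg-D : ∀ x → outdeg x D ≡ k
    outdeg-D x = m+m≡n+n⇒m≡n (outdeg x D) k (begin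
      outdeg x D + outdeg x D   ≡⟨ cong (outdeg x D +_) (proj₂ eulerian x) ⟩
      deg x D                   ≡⟨ deg-orient x otherArcs (proj₁ eulerian) ⟩
      deg x otherArcs           ≡⟨ deg-otherArcs k regular′ x ⟩
      k + k                     ∎)
      where open ≡-Reasoning
    D-adjacent : ArcsAdjacent D
    D-adjacent = orient-adjacent otherArcs (proj₁ eulerian) otherArcs-adjacent
    centres-D : ArcPermutation D
    centres-D = oneFactor⇒permutation (oneFactor k′ D (outdeg-D , λ x → trans (sym (proj₂ eulerian x)) (outdeg-D x))
                                                       (adjacent⇒loops≡0 D D-adjacent))
    arcs-adjacent : ArcsAdjacent (D ++ matchingArcs)
    arcs-adjacent e∈ with ∈-++⁻ D e∈
    ... | inj₁ e∈D = D-adjacent e∈D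
    ... | inj₂ e∈M = matchingArcs-adjacent e∈M
    arcs-cover : ∀ {x y} → Adj G x y → sumBy (multiplicity x y) (D ++ matchingArcs) ≡ 1
    arcs-cover {x} {y} x~y = begin
      sumBy μ (D ++ matchingArcs)              ≡⟨ sumBy-++ μ D matchingArcs ⟩
      sumBy μ D + sumBy μ matchingArcs         ≡⟨ cong (_+ sumBy μ matchingArcs)
                                                    (sumBy-orient μ (multiplicity-swap x y) otherArcs (proj₁ eulerian)) ⟩
      sumBy μ otherArcs + sumBy μ matchingArcs ≡⟨ +-comm (sumBy μ otherArcs) _ ⟩
      sumBy μ matchingArcs + sumBy μ otherArcs ≡⟨ sumBy-partition matched? μ edges ⟩
      sumBy μ edges                            ≡⟨ edges-cover x~y ⟩
      1                                        ∎
      where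
      open ≡-Reasoning
      μ : Fin n × Fin n → ℕ
      μ = multiplicity x y

-- The double stars

module DoubleStars {n : ℕ} (G : Graph n) (triangle-free : TriangleFree G) (k₁ k₂ : ℕ)
  (S : GraphOrientation.Skeleton G (suc (k₁ + k₂))) where

  open Arcs (_≟_ {n})
  open GraphOrientation G
  open Skeleton S
  open OneFactors.ArcPermutation centres

  multiplicity≤1 : ∀ x z → sumBy (multiplicity x z) arcs ≤ 1
  multiplicity≤1 x z with adj? x z
  ... | yes x~z = ≤-reflexive (arcs-cover x~z)
  ... | no x≁z = ≤-trans (≤-reflexive (trans (sumBy-cong-∈ arcs (λ e e∈ → 𝟙-no (sameEdge? x z e) (not-xz e∈))) (sumBy-zero arcs))) z≤n
    where
    not-xz : ∀ {e} → e ∈ arcs → ¬ SameEdge x z e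
    not-xz e∈ (inj₁ (refl , refl)) = x≁z (arcs-adjacent e∈)
    not-xz e∈ (inj₂ (refl , refl)) = x≁z (adj-sym (arcs-adjacent e∈))

  δδ≤multiplicity : ∀ x z e → δ x (proj₁ e) * δ z (proj₂ e) ≤ multiplicity x z e
  δδ≤multiplicity x z e with x ≟ proj₁ e | z ≟ proj₂ e
  ... | yes x≡ | yes z≡ = ≤-reflexive (sym (𝟙-yes (sameEdge? x z e) (inj₁ (sym x≡ , sym z≡))))
  ... | yes _  | no _   = z≤n
  ... | no _   | _      = z≤n

  φ-arc-twice : ∀ x → (φ x , x) ∈ arcs → ⊥
  φ-arc-twice x back = <⇒≱ (s≤s (multiplicity≤1 x (φ x)))
    (∈-distinct⇒2≤sumBy (multiplicity x (φ x)) arcs (φ-arc x) back (λ eq → x≢φx (cong proj₁ eq))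
      (≤-reflexive (sym (𝟙-yes (sameEdge? x (φ x) (x , φ x)) (inj₁ (refl , refl)))))
      (≤-reflexive (sym (𝟙-yes (sameEdge? x (φ x) (φ x , x)) (inj₂ (refl , refl))))))
    where
    x≢φx : x ≢ φ x
    x≢φx = adj⇒≢ (arcs-adjacent (φ-arc x))

  outArcs : Fin n → List (Fin n × Fin n)
  outArcs y = filter (λ e → y ≟ proj₁ e) arcs

  sumBy-outArcs : ∀ y (w : Fin n × Fin n → ℕ) → sumBy w (outArcs y) ≡ sumBy (λ e → δ y (proj₁ e) * w e) arcs
  sumBy-outArcs y w = sumBy-filter (λ e → y ≟ proj₁ e) w arcs

  ∈-outArcs : ∀ y {e} → e ∈ outArcs y → e ∈ arcs × y ≡ proj₁ e
  ∈-outArcs y e∈ = ∈-filter⁻ (λ e → y ≟ proj₁ e) {xs = arcs} e∈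

  centralArcs otherArcs : Fin n → List (Fin n × Fin n)
  centralArcs y = filter (λ e → φ y ≟ proj₂ e) (outArcs y)
  otherArcs y = filter (λ e → ¬? (φ y ≟ proj₂ e)) (outArcs y)

  length-centralArcs : ∀ y → length (centralArcs y) ≡ 1
  length-centralArcs y = ≤-antisym at-most-one at-least-one
    where
    open ≤-Reasoning
    at-most-one : length (centralArcs y) ≤ 1
    at-most-one = begin
      length (centralArcs y)                                  ≡⟨ length-filter≡sumBy𝟙 _ (outArcs y) ⟩
      sumBy (λ e → δ (φ y) (proj₂ e)) (outArcs y)            ≡⟨ sumBy-outArcs y _ ⟩
      sumBy (λ e → δ y (proj₁ e) * δ (φ y) (proj₂ e)) arcs   ≤⟨ sumBy-mono arcs (δδ≤multiplicity y (φ y)) ⟩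
      sumBy (multiplicity y (φ y)) arcs                       ≤⟨ multiplicity≤1 y (φ y) ⟩
      1                                                       ∎
    at-least-one : 1 ≤ length (centralArcs y)
    at-least-one = begin
      1                                      ≤⟨ ∈⇒≤sumBy (λ _ → 1) (centralArcs y) central ⟩
      sumBy (λ _ → 1) (centralArcs y)       ≡⟨ sym (length≡sumBy1 (centralArcs y)) ⟩
      length (centralArcs y)                 ∎
      where
      central : (y , φ y) ∈ centralArcs y
      central = ∈-filter⁺ (λ e → φ y ≟ proj₂ e) (∈-filter⁺ (λ e → y ≟ proj₁ e) (φ-arc y) refl) refl

  sumBy-outArcs-central : ∀ y (w : Fin n × Fin n → ℕ) → sumBy w (outArcs y) ≡ w (y , φ y) + sumBy w (otherArcs y)
  sumBy-outArcs-central y w = trans (sym (sumBy-partition (λ e → φ y ≟ proj₂ e) w (outArcs y)))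
    (cong (_+ sumBy w (otherArcs y)) (sumBy-singleton w (y , φ y) (centralArcs y) (length-centralArcs y) is-central))
    where
    is-central : ∀ e → e ∈ centralArcs y → e ≡ (y , φ y)
    is-central e e∈ with ∈-filter⁻ (λ e → φ y ≟ proj₂ e) {xs = outArcs y} e∈
    ... | e∈out , φy≡ = cong₂ _,_ (sym (proj₂ (∈-outArcs y e∈out))) (sym φy≡)

  leavesAtCentre : Fin n → ℕ
  leavesAtCentre x = k₁ + excess x

  length-otherArcs : ∀ y → length (otherArcs y) ≡ leavesAtCentre y + k₂
  length-otherArcs y = suc-injective (begin
    1 + length (otherArcs y)
      ≡⟨ cong (_+ length (otherArcs y)) (sym (length-centralArcs y)) ⟩
    length (centralArcs y) + length (otherArcs y)
      ≡⟨ cong₂ _+_ (length≡sumBy1 (centralArcs y)) (length≡sumBy1 (otherArcs y)) ⟩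
    sumBy (λ _ → 1) (centralArcs y) + sumBy (λ _ → 1) (otherArcs y)
      ≡⟨ sumBy-partition (λ e → φ y ≟ proj₂ e) (λ _ → 1) (outArcs y) ⟩
    sumBy (λ _ → 1) (outArcs y)
      ≡⟨ sym (length≡sumBy1 (outArcs y)) ⟩
    length (outArcs y)
      ≡⟨ length-filter≡sumBy𝟙 (λ e → y ≟ proj₁ e) arcs ⟩
    outdeg y arcs
      ≡⟨ outdeg-arcs y ⟩
    suc (k₁ + k₂) + excess y
      ≡⟨ cong suc (xy∙z≈xz∙y k₁ k₂ (excess y)) ⟩
    1 + (leavesAtCentre y + k₂) ∎)
    where open ≡-Reasoning

  otherArcs-heads-once : ∀ y z → sumBy (λ e → δ z (proj₂ e)) (otherArcs y) ≤ 1
  otherArcs-heads-once y z = begin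
    sumBy (λ e → δ z (proj₂ e)) (otherArcs y)
      ≤⟨ m≤n+m _ _ ⟩
    sumBy (λ e → δ z (proj₂ e)) (centralArcs y) + sumBy (λ e → δ z (proj₂ e)) (otherArcs y)
      ≡⟨ sumBy-partition (λ e → φ y ≟ proj₂ e) _ (outArcs y) ⟩
    sumBy (λ e → δ z (proj₂ e)) (outArcs y)
      ≡⟨ sumBy-outArcs y _ ⟩
    sumBy (λ e → δ y (proj₁ e) * δ z (proj₂ e)) arcs
      ≤⟨ sumBy-mono arcs (δδ≤multiplicity y z) ⟩
    sumBy (multiplicity y z) arcs
      ≤⟨ multiplicity≤1 y z ⟩
    1 ∎
    where open ≤-Reasoning

  ownArcs lentArcs : Fin n → List (Fin n × Fin n)
  ownArcs y = take (leavesAtCentre y) (otherArcs y)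
  lentArcs y = drop (leavesAtCentre y) (otherArcs y)

  ∈-ownArcs : ∀ y {e} → e ∈ ownArcs y → (e ∈ arcs × y ≡ proj₁ e) × φ y ≢ proj₂ e
  ∈-ownArcs y e∈ with ∈-filter⁻ (λ e → ¬? (φ y ≟ proj₂ e)) {xs = outArcs y}
                      (subst (_ ∈_) (take++drop≡id (leavesAtCentre y) (otherArcs y)) (∈-++⁺ˡ e∈))
  ... | e∈out , φy≢ = ∈-outArcs y e∈out , φy≢

  ∈-lentArcs : ∀ y {e} → e ∈ lentArcs y → e ∈ arcs × y ≡ proj₁ e
  ∈-lentArcs y e∈ = ∈-outArcs y (proj₁ (∈-filter⁻ (λ e → ¬? (φ y ≟ proj₂ e)) {xs = outArcs y}
    (subst (_ ∈_) (take++drop≡id (leavesAtCentre y) (otherArcs y)) (∈-++⁺ʳ (ownArcs y) e∈))))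

  ownLeafList lentLeafList : Fin n → List (Fin n)
  ownLeafList x = map proj₂ (ownArcs x)
  lentLeafList x = map proj₂ (lentArcs (φ x))

  length-ownLeafList : ∀ x → length (ownLeafList x) ≡ leavesAtCentre x
  length-ownLeafList x = begin
    length (ownLeafList x)                                   ≡⟨ length-map proj₂ (ownArcs x) ⟩
    length (ownArcs x)                                       ≡⟨ length-take (leavesAtCentre x) (otherArcs x) ⟩
    leavesAtCentre x ⊓ length (otherArcs x)                  ≡⟨ cong (leavesAtCentre x ⊓_) (length-otherArcs x) ⟩
    leavesAtCentre x ⊓ (leavesAtCentre x + k₂)               ≡⟨ m≤n⇒m⊓n≡m (m≤m+n (leavesAtCentre x) k₂) ⟩
    leavesAtCentre x                                         ∎
    where open ≡-Reasoning

  length-lentLeafList : ∀ x → length (lentLeafList x) ≡ k₂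
  length-lentLeafList x = begin
    length (lentLeafList x)                                  ≡⟨ length-map proj₂ (lentArcs (φ x)) ⟩
    length (lentArcs (φ x))                                  ≡⟨ length-drop (leavesAtCentre (φ x)) (otherArcs (φ x)) ⟩
    length (otherArcs (φ x)) ∸ leavesAtCentre (φ x)          ≡⟨ cong (_∸ leavesAtCentre (φ x)) (length-otherArcs (φ x)) ⟩
    leavesAtCentre (φ x) + k₂ ∸ leavesAtCentre (φ x)         ≡⟨ m+n∸m≡n (leavesAtCentre (φ x)) k₂ ⟩
    k₂                                                       ∎
    where open ≡-Reasoning

  ownLeafList-once : ∀ x → AtMostOnce (ownLeafList x)
  ownLeafList-once x z = begin
    sumBy (δ z) (ownLeafList x)                              ≡⟨ sumBy-map (δ z) proj₂ (ownArcs x) ⟩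
    sumBy (λ e → δ z (proj₂ e)) (ownArcs x)                  ≤⟨ m≤m+n _ _ ⟩
    sumBy (λ e → δ z (proj₂ e)) (ownArcs x) + sumBy (λ e → δ z (proj₂ e)) (lentArcs x)
                                                             ≡⟨ sumBy-take+drop _ (leavesAtCentre x) (otherArcs x) ⟩
    sumBy (λ e → δ z (proj₂ e)) (otherArcs x)                ≤⟨ otherArcs-heads-once x z ⟩
    1                                                        ∎
    where open ≤-Reasoning

  lentLeafList-once : ∀ x → AtMostOnce (lentLeafList x)
  lentLeafList-once x z = begin
    sumBy (δ z) (lentLeafList x)                             ≡⟨ sumBy-map (δ z) proj₂ (lentArcs (φ x)) ⟩
    sumBy (λ e → δ z (proj₂ e)) (lentArcs (φ x))             ≤⟨ m≤n+m _ _ ⟩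
    sumBy (λ e → δ z (proj₂ e)) (ownArcs (φ x)) + sumBy (λ e → δ z (proj₂ e)) (lentArcs (φ x))
                                                             ≡⟨ sumBy-take+drop _ (leavesAtCentre (φ x)) (otherArcs (φ x)) ⟩
    sumBy (λ e → δ z (proj₂ e)) (otherArcs (φ x))            ≤⟨ otherArcs-heads-once (φ x) z ⟩
    1                                                        ∎
    where open ≤-Reasoning

  ownLeaf : (x : Fin n) → Fin (leavesAtCentre x) → Fin n
  ownLeaf x = enumerate (ownLeafList x) (length-ownLeafList x)

  lentLeaf : (x : Fin n) → Fin k₂ → Fin n
  lentLeaf x = enumerate (lentLeafList x) (length-lentLeafList x)

  ownLeaf-arc : ∀ x i → (x , ownLeaf x i) ∈ arcs × φ x ≢ ownLeaf x i
  ownLeaf-arc x i with ∈-map⁻ proj₂ (enumerate-∈ (ownLeafList x) (length-ownLeafList x) i)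
  ... | (u , v) , uv∈ , refl with ∈-ownArcs x uv∈
  ...   | (uv∈arcs , refl) , φx≢v = uv∈arcs , φx≢v

  lentLeaf-arc : ∀ x j → (φ x , lentLeaf x j) ∈ arcs
  lentLeaf-arc x j with ∈-map⁻ proj₂ (enumerate-∈ (lentLeafList x) (length-lentLeafList x) j)
  ... | (u , v) , uv∈ , refl with ∈-lentArcs (φ x) uv∈
  ...   | uv∈arcs , refl = uv∈arcs

  leaf : (x : Fin n) → Fin (leavesAtCentre x) ⊎ Fin k₂ → Fin n
  leaf x = [ ownLeaf x , lentLeaf x ]′

  starMap : (x : Fin n) → Fin (2 + leavesAtCentre x + k₂) → Fin n
  starMap x zero = x
  starMap x (suc zero) = φ x
  starMap x (suc (suc i)) = leaf x (splitAt (leavesAtCentre x) i)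

  centre≢φ : ∀ x → x ≢ φ x
  centre≢φ x = adj⇒≢ (arcs-adjacent (φ-arc x))

  centre≢leaf : ∀ x u → x ≢ leaf x u
  centre≢leaf x (inj₁ i) = adj⇒≢ (arcs-adjacent (proj₁ (ownLeaf-arc x i)))
  centre≢leaf x (inj₂ j) x≡ = φ-arc-twice x (subst (λ v → (φ x , v) ∈ arcs) (sym x≡) (lentLeaf-arc x j))

  φ≢leaf : ∀ x u → φ x ≢ leaf x u
  φ≢leaf x (inj₁ i) = proj₂ (ownLeaf-arc x i)
  φ≢leaf x (inj₂ j) = adj⇒≢ (arcs-adjacent (lentLeaf-arc x j))

  ownLeaf≢lentLeaf : ∀ x i j → ownLeaf x i ≢ lentLeaf x j
  ownLeaf≢lentLeaf x i j eq = triangle-free x (φ x) (ownLeaf x i)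
    (arcs-adjacent (φ-arc x))
    (subst (Adj G (φ x)) (sym eq) (arcs-adjacent (lentLeaf-arc x j)))
    (arcs-adjacent (proj₁ (ownLeaf-arc x i)))

  leaf-injective : ∀ x u v → leaf x u ≡ leaf x v → u ≡ v
  leaf-injective x (inj₁ i) (inj₁ j) eq =
    cong inj₁ (enumerate-injective (ownLeafList x) (length-ownLeafList x) (ownLeafList-once x) i j eq)
  leaf-injective x (inj₁ i) (inj₂ j) eq = ⊥-elim (ownLeaf≢lentLeaf x i j eq)
  leaf-injective x (inj₂ i) (inj₁ j) eq = ⊥-elim (ownLeaf≢lentLeaf x j i (sym eq))
  leaf-injective x (inj₂ i) (inj₂ j) eq =
    cong inj₂ (enumerate-injective (lentLeafList x) (length-lentLeafList x) (lentLeafList-once x) i j eq)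

  starMap-injective : ∀ x → Injective _≡_ _≡_ (starMap x)
  starMap-injective x {zero} {zero} eq = refl
  starMap-injective x {zero} {suc zero} eq = ⊥-elim (centre≢φ x eq)
  starMap-injective x {zero} {suc (suc j)} eq = ⊥-elim (centre≢leaf x (splitAt (leavesAtCentre x) j) eq)
  starMap-injective x {suc zero} {zero} eq = ⊥-elim (centre≢φ x (sym eq))
  starMap-injective x {suc zero} {suc zero} eq = refl
  starMap-injective x {suc zero} {suc (suc j)} eq = ⊥-elim (φ≢leaf x (splitAt (leavesAtCentre x) j) eq)
  starMap-injective x {suc (suc i)} {zero} eq = ⊥-elim (centre≢leaf x (splitAt (leavesAtCentre x) i) (sym eq))
  starMap-injective x {suc (suc i)} {suc zero} eq = ⊥-elim (φ≢leaf x (splitAt (leavesAtCentre x) i) (sym eq))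
  starMap-injective x {suc (suc i)} {suc (suc j)} eq = cong (λ l → suc (suc l)) (begin
    i                                             ≡⟨ sym (join-splitAt ℓ k₂ i) ⟩
    join ℓ k₂ (splitAt ℓ i)                       ≡⟨ cong (join ℓ k₂) (leaf-injective x (splitAt ℓ i) (splitAt ℓ j) eq) ⟩
    join ℓ k₂ (splitAt ℓ j)                       ≡⟨ join-splitAt ℓ k₂ j ⟩
    j                                             ∎)
    where
    open ≡-Reasoning
    ℓ : ℕ
    ℓ = leavesAtCentre x

  starArcs : Fin n → List (Fin n × Fin n)
  starArcs x = (x , φ x) ∷ (ownArcs x ++ lentArcs (φ x))

  starArcs⊆arcs : ∀ x {e} → e ∈ starArcs x → e ∈ arcs
  starArcs⊆arcs x (here refl) = φ-arc x
  starArcs⊆arcs x (there e∈) with ∈-++⁻ (ownArcs x) e∈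
  ... | inj₁ e∈own = proj₁ (proj₁ (∈-ownArcs x e∈own))
  ... | inj₂ e∈lent = proj₁ (∈-lentArcs (φ x) e∈lent)

  starMap-arcs : ∀ x → map (λ e → (starMap x (proj₁ e) , starMap x (proj₂ e))) (dsEdges (leavesAtCentre x) k₂) ≡ starArcs x
  starMap-arcs x = cong ((x , φ x) ∷_) (trans (map-++ image atCentre atφ) (cong₂ _++_ own lent))
    where
    open ≡-Reasoning
    ℓ : ℕ
    ℓ = leavesAtCentre x
    image : Fin (2 + ℓ + k₂) × Fin (2 + ℓ + k₂) → Fin n × Fin n
    image e = starMap x (proj₁ e) , starMap x (proj₂ e)
    atCentre : List (Fin (2 + ℓ + k₂) × Fin (2 + ℓ + k₂))
    atCentre = map (λ i → zero , suc (suc (i ↑ˡ k₂))) (allFin ℓ)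
    atφ : List (Fin (2 + ℓ + k₂) × Fin (2 + ℓ + k₂))
    atφ = map (λ j → suc zero , suc (suc (ℓ ↑ʳ j))) (allFin k₂)
    own : map image atCentre ≡ ownArcs x
    own = begin
      map image atCentre                                ≡⟨ sym (map-∘ (allFin ℓ)) ⟩
      map (λ i → image (zero , suc (suc (i ↑ˡ k₂)))) (allFin ℓ)
        ≡⟨ map-cong (λ i → cong (λ u → x , leaf x u) (splitAt-↑ˡ ℓ i k₂)) (allFin ℓ) ⟩
      map (λ i → x , ownLeaf x i) (allFin ℓ)            ≡⟨ map-∘ (allFin ℓ) ⟩
      map (λ v → x , v) (map (ownLeaf x) (allFin ℓ))           ≡⟨ cong (map (λ v → x , v)) (map-enumerate (ownLeafList x) (length-ownLeafList x)) ⟩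
      map (λ v → x , v) (ownLeafList x)                        ≡⟨ map-tails x (ownArcs x) (λ e∈ → proj₂ (proj₁ (∈-ownArcs x e∈))) ⟩
      ownArcs x                                         ∎
    lent : map image atφ ≡ lentArcs (φ x)
    lent = begin
      map image atφ                                     ≡⟨ sym (map-∘ (allFin k₂)) ⟩
      map (λ j → image (suc zero , suc (suc (ℓ ↑ʳ j)))) (allFin k₂)
        ≡⟨ map-cong (λ j → cong (λ u → φ x , leaf x u) (splitAt-↑ʳ ℓ k₂ j)) (allFin k₂) ⟩
      map (λ j → φ x , lentLeaf x j) (allFin k₂)        ≡⟨ map-∘ (allFin k₂) ⟩
      map (λ v → φ x , v) (map (lentLeaf x) (allFin k₂))       ≡⟨ cong (map (λ v → φ x , v)) (map-enumerate (lentLeafList x) (length-lentLeafList x)) ⟩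
      map (λ v → φ x , v) (lentLeafList x)                     ≡⟨ map-tails (φ x) (lentArcs (φ x)) (λ e∈ → proj₂ (∈-lentArcs (φ x) e∈)) ⟩
      lentArcs (φ x)                                    ∎

  star : Fin n → DSCopy G
  star x = record
    { a = leavesAtCentre x ; b = k₂ ; f = starMap x ; f-inj = starMap-injective x
    ; f-edge = All.map⁻ (subst (All (λ e → Adj G (proj₁ e) (proj₂ e))) (sym (starMap-arcs x))
                                (All.tabulate (λ e∈ → arcs-adjacent (starArcs⊆arcs x e∈)))) }

  -- Reindexing the lent arcs along the permutation φ reunites them with the other out-arcs.
  sumBy-stars : (w : Fin n × Fin n → ℕ) → sumBy (λ z → sumBy w (starArcs z)) (allFin n) ≡ sumBy w arcs
  sumBy-stars w = begin
    sumBy (λ z → sumBy w (starArcs z)) (allFin n)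
      ≡⟨ sumBy-cong (allFin n) (λ z → trans (cong (w (z , φ z) +_) (sumBy-++ w (ownArcs z) (lentArcs (φ z))))
                                            (sym (+-assoc (w (z , φ z)) _ _))) ⟩
    sumBy (λ z → (w (z , φ z) + sumBy w (ownArcs z)) + sumBy w (lentArcs (φ z))) (allFin n)
      ≡⟨ sumBy-+ _ _ (allFin n) ⟩
    sumBy (λ z → w (z , φ z) + sumBy w (ownArcs z)) (allFin n) + sumBy (λ z → sumBy w (lentArcs (φ z))) (allFin n)
      ≡⟨ cong (sumBy (λ z → w (z , φ z) + sumBy w (ownArcs z)) (allFin n) +_)
              (sumBy-allFin-permute φ ψ φ∘ψ ψ∘φ (λ z → sumBy w (lentArcs z))) ⟩
    sumBy (λ z → w (z , φ z) + sumBy w (ownArcs z)) (allFin n) + sumBy (λ z → sumBy w (lentArcs z)) (allFin n)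
      ≡⟨ sym (sumBy-+ _ _ (allFin n)) ⟩
    sumBy (λ z → (w (z , φ z) + sumBy w (ownArcs z)) + sumBy w (lentArcs z)) (allFin n)
      ≡⟨ sumBy-cong (allFin n) (λ z → trans (+-assoc (w (z , φ z)) _ _)
           (trans (cong (w (z , φ z) +_) (sumBy-take+drop w (leavesAtCentre z) (otherArcs z)))
                  (sym (sumBy-outArcs-central z w)))) ⟩
    sumBy (λ z → sumBy w (outArcs z)) (allFin n)
      ≡⟨ sumBy-cong (allFin n) (λ z → sumBy-outArcs z w) ⟩
    sumBy (λ z → sumBy (λ e → δ z (proj₁ e) * w e) arcs) (allFin n)
      ≡⟨ sumBy-swap (λ z e → δ z (proj₁ e) * w e) (allFin n) arcs ⟩
    sumBy (λ e → sumBy (λ z → δ z (proj₁ e) * w e) (allFin n)) arcs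
      ≡⟨ sumBy-cong arcs (λ e → trans (sumBy-cong (allFin n) (λ z → cong (_* w e) (δ-sym z (proj₁ e))))
                                      (sumBy-allFin-δ (proj₁ e) (λ _ → w e))) ⟩
    sumBy w arcs ∎
    where open ≡-Reasoning

  stars : List (DSCopy G)
  stars = map star (allFin n)

  star-shape : ∀ x → (leavesAtCentre x , k₂) ∈ ((k₁ , k₂) ∷ (suc k₁ , k₂) ∷ [])
  star-shape x with excess x | excess≤1 x
  ... | zero | _ = here (cong (_, k₂) (+-identityʳ k₁))
  ... | suc zero | _ = there (here (cong (_, k₂) (+-comm k₁ 1)))
  ... | suc (suc _) | s≤s ()

  decomposable : Decomposable G ((k₁ , k₂) ∷ (suc k₁ , k₂) ∷ [])
  decomposable = stars , All.map⁺ (All.tabulate (λ {x} _ → star-shape x)) , λ x y x~y → begin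
    length (filter (sameEdge? x y) (concatMap copyEdges stars))  ≡⟨ length-filter≡sumBy𝟙 (sameEdge? x y) (concatMap copyEdges stars) ⟩
    sumBy (multiplicity x y) (concatMap copyEdges stars)         ≡⟨ sumBy-concatMap _ copyEdges stars ⟩
    sumBy (λ c → sumBy (multiplicity x y) (copyEdges c)) stars   ≡⟨ sumBy-map _ star (allFin n) ⟩
    sumBy (λ z → sumBy (multiplicity x y) (copyEdges (star z))) (allFin n)
      ≡⟨ sumBy-cong (allFin n) (λ z → cong (sumBy (multiplicity x y)) (starMap-arcs z)) ⟩
    sumBy (λ z → sumBy (multiplicity x y) (starArcs z)) (allFin n)  ≡⟨ sumBy-stars (multiplicity x y) ⟩
    sumBy (multiplicity x y) arcs                                  ≡⟨ arcs-cover x~y ⟩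
    1                                                              ∎
    where open ≡-Reasoning

mainTheorem7 : (n k k₁ k₂ : ℕ) (G : Graph n) →
    TriangleFree G → Regular G (2 * k + 1) → HasPerfectMatching G →
    k₁ ≥ 1 → k₂ ≥ 1 → suc (k₁ + k₂) ≡ k →
    Decomposable G ((k₁ , k₂) ∷ (suc k₁ , k₂) ∷ [])
-- The construction does not need k₁ ≥ 1 or k₂ ≥ 1.
mainTheorem7 n .(suc (k₁ + k₂)) k₁ k₂ G triangle-free regular matching _ _ refl =
  DoubleStars.decomposable G triangle-free k₁ k₂ (GraphOrientation.skeleton G (k₁ + k₂) regular matching)
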